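{- Let $G$ be a finite, connected, simple undirected graph with vertices $v_0,\dots,v_n$ and edge set $E$, with sink $v_0$. Let $\lambda_0$ be the Pak–Stanley labeling of the regions of the $(G,v_0)$-semiorder arrangement and $\widetilde{\mathcal{R}}_0$ its set of admissible regions (both defined in the context). Then $$\lambda_0(\widetilde{\mathcal{R}}_0)=\widetilde{\mathcal{S}}_0=\{c-v_0:\ c \text{ a superstable configuration on } G\}.$$
   Context: Divisors are elements of $\mathbb{Z}V$, $V=\{v_0,\dots,v_n\}$; configurations on $G$ (sink $v_0$) are elements of $\mathbb{Z}(V\setminus\{v_0\})$; inequalities are componentwise. For a graph $H$ with sink, a configuration $c\ge0$ is superstable if no nonempty set $Y$ of nonsink vertices has $c-\widetilde{\Delta}1_Y\ge0$, $\widetilde\Delta$ being the Laplacian $D-A$ of $H$ with the sink's row and column removed. $K(G)$ is $G$ plus a new sink $\tilde q$ adjacent to every vertex of $V$; $\mathcal{S}=\{c\in\mathbb{Z}V: c+\sum_{v\in V}v\text{ superstable on }K(G)\}$ and $\widetilde{\mathcal{S}}_0=\{c\in\mathcal{S}:c_{v_0}=-1,\ c+v_0\ge0\}$. The $(G,v_0)$-semiorder arrangement $\mathscr{I}_0$ is the set of hyperplanes $x_i-x_j=1$ in $\mathbb{R}^n$ (coordinates $x_1,\dots,x_n$) for ordered pairs $i\neq j$, both nonzero, with $\{v_i,v_j\}\in E$; its regions are the connected components of the complement. Labeling $\lambda_0$: label the central region ($|x_i-x_j|<1$ for all distinct nonzero $i,j$ with $\{v_i,v_j\}\in E$) by the divisor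 assigning $0$ to each $v_i$ adjacent to $v_0$ and $-1$ to all other vertices including $v_0$, and queue it; while the queue is nonempty, remove its first region $r$, and for each unlabeled region $r'$ bordering $r$, determine the unique $i\neq j$ with $|x_i-x_j|<1$ on $r$ and $x_j>x_i+1$ on $r'$, label $r'$ by (label of $r$)$+v_j$ and queue $r'$. Admissible regions: for $i=1,\dots,n$ let $\mathbb{R}^n_{(i,0)}=\mathbb{R}^n$ if $\{v_i,v_0\}\in E$, and otherwise $\mathbb{R}^n_{(i,0)}=\{x\in\mathbb{R}^n: x_i>x_j+1 \text{ for some } j \text{ with }\{v_i,v_j\}\in E\}$; let $\widetilde{\mathbb{R}}^n=\bigcap_{i=1}^n\mathbb{R}^n_{(i,0)}$. The admissible regions $\widetilde{\mathcal{R}}_0$ are the connected components of $\widetilde{\mathbb{R}}^n$ minus the union of the hyperplanes of $\mathscr{I}_0$.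
   Formalization: The regions of the $(G,v_0)$-semiorder arrangement, admissible or not, are taken in ℚ^n rather than $\mathbb{R}^n$, each represented by its points with rational coordinates. -}

module Defs where

open import Data.Nat using (ℕ; zero; suc)
open import Data.Bool using (Bool; true; false; if_then_else_)
open import Data.Fin using (Fin; zero; suc)
import Data.Fin as F
open import Data.Fin.Subset using (Subset; Nonempty; _∈_)
open import Data.Integer as ℤ using (ℤ; 0ℤ; 1ℤ; -1ℤ)
open import Data.Rational as ℚ using (ℚ; 1ℚ)
open import Data.Vec using (Vec; []; _∷_; lookup; tabulate; updateAt)
open import Data.Product using (Σ; ∃; ∃-syntax; _×_; _,_)
open import Data.Sum using (_⊎_)
open import Relation.Nullary using (¬_; does)
open import Relation.Binary.PropositionalEquality using (_≡_; _≢_)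
open import Function.Bundles using (_⇔_)

data Walk {m : ℕ} (adj : Fin m → Fin m → Bool) : Fin m → Fin m → Set where
  here : ∀ {u} → Walk adj u u
  step : ∀ {u w t} → adj u w ≡ true → Walk adj w t → Walk adj u t

-- finite, connected, simple, undirected graph with vertices v₀ … vₙ
-- (v_i = i : Fin (suc n)); sink v₀ = zero
record SimpleGraph (n : ℕ) : Set where
  field
    adj       : Fin (suc n) → Fin (suc n) → Bool
    symmetric : ∀ u w → adj u w ≡ adj w u
    loopless  : ∀ u → adj u u ≡ false
    connected : ∀ u → Walk adj zero u
open SimpleGraph public

sumℤ : ∀ {k} → (Fin k → ℤ) → ℤ
sumℤ {zero}  f = 0ℤ
sumℤ {suc k} f = f zero ℤ.+ sumℤ (λ i → f (suc i))

b2z : Bool → ℤ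
b2z true  = 1ℤ
b2z false = 0ℤ

degree : ∀ {m} → (Fin (suc m) → Fin (suc m) → Bool) → Fin (suc m) → ℤ
degree adj u = sumℤ (λ w → b2z (adj u w))

laplacian : ∀ {m} → (Fin (suc m) → Fin (suc m) → Bool) →
            Fin (suc m) → Fin (suc m) → ℤ
laplacian adj u w = if does (u F.≟ w) then degree adj u else ℤ.- b2z (adj u w)

indicator : ∀ {m} → Subset m → Fin m → ℤ
indicator Y b = b2z (lookup Y b)

-- (Δ̃ 1_Y)(a): reduced Laplacian (sink row/column removed) applied to 1_Y
reducedLapInd : ∀ {m} → (Fin (suc m) → Fin (suc m) → Bool) → Subset m → Fin m → ℤ
reducedLapInd adj Y a = sumℤ (λ b → laplacian adj (suc a) (suc b) ℤ.* indicator Y b)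

-- configurations: Vec ℤ m (values on the nonsink vertices suc a)
Superstable : ∀ {m} → (Fin (suc m) → Fin (suc m) → Bool) → Vec ℤ m → Set
Superstable {m} adj c =
  (∀ a → 0ℤ ℤ.≤ lookup c a) ×
  (∀ (Y : Subset m) → Nonempty Y →
     ¬ (∀ a → 0ℤ ℤ.≤ lookup c a ℤ.- reducedLapInd adj Y a))

Divisor : ℕ → Set
Divisor n = Vec ℤ (suc n)

-- K(G): new sink q̃ = zero adjacent to every vertex of V (V shifted by suc)
Kadj : ∀ {n} → SimpleGraph n → Fin (suc (suc n)) → Fin (suc (suc n)) → Bool
Kadj G zero    zero    = false
Kadj G zero    (suc _) = true
Kadj G (suc _) zero    = true
Kadj G (suc u) (suc w) = adj G u w

addOnes : ∀ {k} → Vec ℤ k → Vec ℤ k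
addOnes []       = []
addOnes (x ∷ xs) = (x ℤ.+ 1ℤ) ∷ addOnes xs

addVertex : ∀ {n} → Divisor n → Fin (suc n) → Divisor n
addVertex d v = updateAt d v (λ z → z ℤ.+ 1ℤ)

InS : ∀ {n} → SimpleGraph n → Divisor n → Set
InS G c = Superstable (Kadj G) (addOnes c)

InS̃₀ : ∀ {n} → SimpleGraph n → Divisor n → Set
InS̃₀ G c = InS G c × lookup c zero ≡ -1ℤ ×
           (∀ v → 0ℤ ℤ.≤ lookup (addVertex c zero) v)

-- The (G,v₀)-semiorder arrangement, over rational points
-- coordinate i : Fin n is x_{i+1}, corresponding to vertex suc i.

Pt : ℕ → Set
Pt n = Fin n → ℚ

-- hyperplane x_i - x_j = 1 is present (ordered pair, edge {v_i,v_j}, both nonsink)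
HP : ∀ {n} → SimpleGraph n → Fin n → Fin n → Set
HP G i j = adj G (suc i) (suc j) ≡ true

Below Above : ∀ {n} → Pt n → Fin n → Fin n → Set
Below x i j = x i ℚ.- x j ℚ.< 1ℚ
Above x i j = 1ℚ ℚ.< x i ℚ.- x j

Generic : ∀ {n} → SimpleGraph n → Pt n → Set
Generic G x = ∀ i j → HP G i j → x i ℚ.- x j ≢ 1ℚ

SameRegion : ∀ {n} → SimpleGraph n → Pt n → Pt n → Set
SameRegion G x y = ∀ i j → HP G i j → (Below x i j ⇔ Below y i j)

Central : ∀ {n} → SimpleGraph n → Pt n → Set
Central G x = ∀ i j → HP G i j → Below x i j

Border : ∀ {n} → SimpleGraph n → Pt n → Pt n → Set
Border G x y = ∃[ i ] ∃[ j ] (HP G i j ×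
  ((Below x i j × Above y i j) ⊎ (Above x i j × Below y i j)) ×
  (∀ k l → HP G k l → ¬ (k ≡ i × l ≡ j) → (Below x k l ⇔ Below y k l)))

Reach : ∀ {n} → SimpleGraph n → ℕ → Pt n → Set
Reach G zero    x = Central G x
Reach G (suc k) x = Reach G k x ⊎
  (∃[ y ] (Generic G y × Reach G k y × Border G y x))

AtDist : ∀ {n} → SimpleGraph n → ℕ → Pt n → Set
AtDist G zero    x = Central G x
AtDist G (suc k) x = Reach G (suc k) x × ¬ Reach G k x

baseLabel : ∀ {n} → SimpleGraph n → Divisor n
baseLabel G = tabulate (λ u → if adj G zero u then 0ℤ else -1ℤ)

-- lab is an outcome of the BFS labeling procedure λ₀ (for some queue order):
-- constant on regions, the central region gets baseLabel, and every other
-- region r' is labeled from a bordering region r one BFS layer earlier by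
-- label(r) + v_j where |x_i - x_j| < 1 on r and x_j > x_i + 1 on r'.
IsPakStanley : ∀ {n} → SimpleGraph n → (Pt n → Divisor n) → Set
IsPakStanley {n} G lab =
  (∀ x y → Generic G x → Generic G y → SameRegion G x y → lab x ≡ lab y) ×
  (∀ x → Generic G x → Central G x → lab x ≡ baseLabel G) ×
  (∀ k x → Generic G x → AtDist G (suc k) x →
     ∃[ y ] (Generic G y × AtDist G k y × Border G y x ×
       ∃[ i ] ∃[ j ] (HP G j i × Below y i j × Below y j i × Above x j i ×
                      lab x ≡ addVertex (lab y) (suc j))))

Admissible : ∀ {n} → SimpleGraph n → Pt n → Set
Admissible {n} G x = ∀ (i : Fin n) →
  (adj G (suc i) zero ≡ true) ⊎ (∃[ j ] (adj G (suc i) (suc j) ≡ true × Above x i j))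

-- The Pak–Stanley label of a region is the central label plus one chip on v_i for
-- every hyperplane x_i − x_j = 1 with x_i − x_j > 1 on the region.  A generic point off
-- the central region can be moved across exactly one such hyperplane towards the centre
-- (contract it, then lift everything above the shortest such jump's lower end), so the
-- BFS distance is the number of these hyperplanes and every Pak–Stanley labeling is
-- this closed form.  On an admissible region, a lowest vertex of any set Y has no such
-- hyperplane towards Y, which is exactly superstability of the label.  Conversely,
-- Dhar's burning algorithm sorts the vertices of a superstable configuration into
-- levels, from which a point with the prescribed counts is built level by level.
-- Finally, superstability on K(G) with no chip on v₀ is superstability on G.

module Submission where

open import Data.Bool using (Bool; true; false; if_then_else_; _∧_; _∨_; not)
import Data.Bool.Properties as Boolₚ
open import Data.Empty using (⊥; ⊥-elim)
open import Data.Fin using (Fin; zero; suc)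
import Data.Fin as Fin
import Data.Fin.Properties as Finₚ
open import Data.Fin.Subset using (Subset; Nonempty)
open import Data.Integer as ℤ using (ℤ; 0ℤ; 1ℤ; -1ℤ; +_)
import Data.Integer.Properties as ℤₚ
import Data.Integer.Solver as ℤ-Solver
import Data.Rational.Solver as ℚ-Solver
import Data.Nat.Solver as ℕ-Solver
import Data.Nat.DivMod as DivMod
open import Data.Nat as ℕ using (ℕ; zero; suc; z≤n; s≤s)
import Data.Nat.Properties as ℕₚ
open import Data.Rational as ℚ using (ℚ; 0ℚ; 1ℚ)
import Data.Rational.Properties as ℚₚ
open import Data.Product using (Σ; ∃; ∃-syntax; _×_; _,_; proj₁; proj₂; uncurry)
open import Data.Sum using (_⊎_; inj₁; inj₂)
open import Data.Vec using (Vec; _∷_; lookup; tabulate)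
import Data.Vec.Properties as Vecₚ
open import Function using (_∘_)
open import Function.Bundles using (_⇔_; mk⇔; Equivalence)
import Function.Properties.Equivalence as ⇔
open import Relation.Binary using (TotalPreorder; Tri; tri<; tri≈; tri>)
open import Relation.Binary.PropositionalEquality
open import Relation.Nullary using (¬_; does; yes; no; Dec)
open import Relation.Nullary.Decidable using (dec-true; dec-false; does-⇔; ¬?; _×-dec_; _⊎-dec_)

open import Defs

open import Algebra.Properties.CommutativeSemigroup ℕₚ.+-commutativeSemigroup
  using () renaming (interchange to ℕ-interchange)
open import Algebra.Properties.CommutativeSemigroup ℤₚ.+-commutativeSemigroup
  using () renaming (interchange to ℤ-interchange)

dec-true⁻¹ : ∀ {P : Set} (d : Dec P) → does d ≡ true → P
dec-true⁻¹ (yes p) _ = p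

dec-false⁻¹ : ∀ {P : Set} (d : Dec P) → does d ≡ false → ¬ P
dec-false⁻¹ (no ¬p) _ = ¬p

does-⊎ : ∀ {P Q R : Set} (p? : Dec P) (q? : Dec Q) (r? : Dec R) →
         (P → Q ⊎ R) → (Q → P) → (R → P) → does p? ≡ does q? ∨ does r?
does-⊎ (yes p) (yes q) r? to fromQ fromR = refl
does-⊎ (yes p) (no ¬q) (yes r) to fromQ fromR = refl
does-⊎ (yes p) (no ¬q) (no ¬r) to fromQ fromR with to p
... | inj₁ q = ⊥-elim (¬q q)
... | inj₂ r = ⊥-elim (¬r r)
does-⊎ (no ¬p) (yes q) r? to fromQ fromR = ⊥-elim (¬p (fromQ q))
does-⊎ (no ¬p) (no ¬q) (yes r) to fromQ fromR = ⊥-elim (¬p (fromR r))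
does-⊎ (no ¬p) (no ¬q) (no ¬r) to fromQ fromR = refl

∧-true⁻¹ : ∀ {a b} → a ∧ b ≡ true → a ≡ true × b ≡ true
∧-true⁻¹ {true} {true} _ = refl , refl

∧-true : ∀ {a b} → a ≡ true → b ≡ true → a ∧ b ≡ true
∧-true refl refl = refl

true≢false : true ≢ false
true≢false ()

≡does : ∀ {P : Set} (p? : Dec P) {b} → (P → b ≡ true) → (¬ P → b ≡ false) → b ≡ does p?
≡does (yes p) ifP _    = ifP p
≡does (no ¬p) _ if¬P = if¬P ¬p

∨-false⁻¹ : ∀ {a b} → a ∨ b ≡ false → a ≡ false × b ≡ false
∨-false⁻¹ {false} {false} _ = refl , refl

lookup-ext : ∀ {A : Set} {k} (u v : Vec A k) → (∀ i → lookup u i ≡ lookup v i) → u ≡ v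
lookup-ext u v eq = begin
  u                  ≡⟨ sym (Vecₚ.tabulate∘lookup u) ⟩
  tabulate (lookup u) ≡⟨ Vecₚ.tabulate-cong eq ⟩
  tabulate (lookup v) ≡⟨ Vecₚ.tabulate∘lookup v ⟩
  v                  ∎
  where open ≡-Reasoning

b2n : Bool → ℕ
b2n true  = 1
b2n false = 0

sumℕ : ∀ {m} → (Fin m → ℕ) → ℕ
sumℕ {zero}  f = 0
sumℕ {suc m} f = f zero ℕ.+ sumℕ (f ∘ suc)

count : ∀ {m} → (Fin m → Bool) → ℕ
count f = sumℕ (b2n ∘ f)

sumℕ-cong : ∀ {m} {f g : Fin m → ℕ} → (∀ i → f i ≡ g i) → sumℕ f ≡ sumℕ g
sumℕ-cong {zero}  eq = refl
sumℕ-cong {suc m} eq = cong₂ ℕ._+_ (eq zero) (sumℕ-cong (eq ∘ suc))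

sumℕ-mono : ∀ {m} {f g : Fin m → ℕ} → (∀ i → f i ℕ.≤ g i) → sumℕ f ℕ.≤ sumℕ g
sumℕ-mono {zero}  le = z≤n
sumℕ-mono {suc m} le = ℕₚ.+-mono-≤ (le zero) (sumℕ-mono (le ∘ suc))

sumℕ-mono-< : ∀ {m} {f g : Fin m → ℕ} → (∀ i → f i ℕ.≤ g i) →
              ∀ k → f k ℕ.< g k → sumℕ f ℕ.< sumℕ g
sumℕ-mono-< {suc m} le zero    lt = ℕₚ.+-mono-<-≤ lt (sumℕ-mono (le ∘ suc))
sumℕ-mono-< {suc m} le (suc k) lt = ℕₚ.+-mono-≤-< (le zero) (sumℕ-mono-< (le ∘ suc) k lt)

sumℕ-suc-at : ∀ {m} {f g : Fin m → ℕ} k → (∀ i → i ≢ k → f i ≡ g i) →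
              g k ≡ suc (f k) → sumℕ g ≡ suc (sumℕ f)
sumℕ-suc-at {suc m} {f} {g} zero eq eqk =
  cong₂ ℕ._+_ eqk (sym (sumℕ-cong (λ i → eq (suc i) λ ())))
sumℕ-suc-at {suc m} {f} {g} (suc k) eq eqk =
  trans (cong₂ ℕ._+_ (sym (eq zero λ ())) (sumℕ-suc-at k (λ i i≢k → eq (suc i) (i≢k ∘ Finₚ.suc-injective)) eqk))
        (ℕₚ.+-suc (f zero) _)

sumℕ-zero : ∀ {m} (f : Fin m → ℕ) → (∀ i → f i ≡ 0) → sumℕ f ≡ 0
sumℕ-zero {zero}  f eq = refl
sumℕ-zero {suc m} f eq = cong₂ ℕ._+_ (eq zero) (sumℕ-zero (f ∘ suc) (eq ∘ suc))

sumℕ≡0⇒ : ∀ {m} (f : Fin m → ℕ) → sumℕ f ≡ 0 → ∀ i → f i ≡ 0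
sumℕ≡0⇒ f eq zero    = ℕₚ.m+n≡0⇒m≡0 (f zero) eq
sumℕ≡0⇒ f eq (suc i) = sumℕ≡0⇒ (f ∘ suc) (ℕₚ.m+n≡0⇒n≡0 (f zero) eq) i

sumℕ-+ : ∀ {m} (f g : Fin m → ℕ) → sumℕ (λ i → f i ℕ.+ g i) ≡ sumℕ f ℕ.+ sumℕ g
sumℕ-+ {zero}  f g = refl
sumℕ-+ {suc m} f g = trans (cong ((f zero ℕ.+ g zero) ℕ.+_) (sumℕ-+ (f ∘ suc) (g ∘ suc)))
                           (ℕ-interchange (f zero) (g zero) _ _)

sumℕ-pos : ∀ {m} (f : Fin m → ℕ) → 1 ℕ.≤ sumℕ f → ∃[ k ] 1 ℕ.≤ f k
sumℕ-pos {suc m} f le with f zero in eq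
... | suc _ = zero , subst (1 ℕ.≤_) (sym eq) (s≤s z≤n)
... | zero  with sumℕ-pos (f ∘ suc) le
...   | k , p = suc k , p

b2n-mono : ∀ {a b} → (a ≡ true → b ≡ true) → b2n a ℕ.≤ b2n b
b2n-mono {false} _ = z≤n
b2n-mono {true}  h rewrite h refl = ℕₚ.≤-refl

count-cong : ∀ {m} {f g : Fin m → Bool} → (∀ i → f i ≡ g i) → count f ≡ count g
count-cong eq = sumℕ-cong (cong b2n ∘ eq)

count-mono : ∀ {m} {f g : Fin m → Bool} → (∀ i → f i ≡ true → g i ≡ true) → count f ℕ.≤ count g
count-mono sub = sumℕ-mono (b2n-mono ∘ sub)

count-mono-< : ∀ {m} {f g : Fin m → Bool} → (∀ i → f i ≡ true → g i ≡ true) →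
               ∀ k → f k ≡ false → g k ≡ true → count f ℕ.< count g
count-mono-< {f = f} {g} sub k fk gk =
  sumℕ-mono-< (b2n-mono ∘ sub) k (subst₂ (λ a b → b2n a ℕ.< b2n b) (sym fk) (sym gk) ℕₚ.≤-refl)

count-suc-at : ∀ {m} {f g : Fin m → Bool} k → (∀ i → i ≢ k → f i ≡ g i) →
               f k ≡ false → g k ≡ true → count g ≡ suc (count f)
count-suc-at k eq fk gk =
  sumℕ-suc-at k (λ i i≢k → cong b2n (eq i i≢k)) (subst₂ (λ a b → b2n b ≡ suc (b2n a)) (sym fk) (sym gk) refl)

count-zero : ∀ {m} (f : Fin m → Bool) → (∀ i → f i ≡ false) → count f ≡ 0
count-zero f none = sumℕ-zero (b2n ∘ f) (cong b2n ∘ none)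

count≡0⇒ : ∀ {m} (f : Fin m → Bool) → count f ≡ 0 → ∀ i → f i ≡ false
count≡0⇒ f eq i with f i | sumℕ≡0⇒ (b2n ∘ f) eq i
... | false | _ = refl

count-≤ : ∀ {m} (f : Fin m → Bool) → count f ℕ.≤ m
count-≤ {zero}  f = z≤n
count-≤ {suc m} f with f zero
... | true  = s≤s (count-≤ (f ∘ suc))
... | false = ℕₚ.m≤n⇒m≤1+n (count-≤ (f ∘ suc))

count-< : ∀ {m} (f : Fin m → Bool) k → f k ≡ false → count f ℕ.< m
count-< {m} f k fk =
  ℕₚ.<-≤-trans (count-mono-< {g = λ _ → true} (λ _ _ → refl) k fk refl) (count-≤ {m} (λ _ → true))

count-pos : ∀ {m} (f : Fin m → Bool) → 1 ℕ.≤ count f → ∃[ k ] f k ≡ true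
count-pos f le with sumℕ-pos (b2n ∘ f) le
... | k , p with f k in eq
...   | true = k , eq

count-≥1 : ∀ {m} (f : Fin m → Bool) k → f k ≡ true → 1 ℕ.≤ count f
count-≥1 {m} f k fk = subst (ℕ._< count f) (count-zero {m} (λ _ → false) (λ _ → refl))
  (count-mono-< (λ _ ()) k refl fk)

count-≤1 : ∀ {m} (f : Fin m → Bool) → (∀ i j → f i ≡ true → f j ≡ true → i ≡ j) → count f ℕ.≤ 1
count-≤1 {zero}  f unique = z≤n
count-≤1 {suc m} f unique with f zero in e
... | true  = s≤s (ℕₚ.≤-reflexive (count-zero (f ∘ suc) rest))
  where
  rest : ∀ i → f (suc i) ≡ false
  rest i with f (suc i) in e′
  ... | true  with () ← unique zero (suc i) e e′
  ... | false = refl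
... | false = count-≤1 (f ∘ suc) (λ i j p q → Finₚ.suc-injective (unique (suc i) (suc j) p q))

count-∨ : ∀ {m} (f g h : Fin m → Bool) → (∀ i → f i ≡ g i ∨ h i) →
          (∀ i → g i ≡ true → h i ≡ false) → count f ≡ count g ℕ.+ count h
count-∨ f g h split disjoint = trans (sumℕ-cong pointwise) (sumℕ-+ (b2n ∘ g) (b2n ∘ h))
  where
  pointwise : ∀ i → b2n (f i) ≡ b2n (g i) ℕ.+ b2n (h i)
  pointwise i rewrite split i with g i in gi | h i in hi
  ... | true  | true  = ⊥-elim (true≢false (trans (sym hi) (disjoint i gi)))
  ... | true  | false = refl
  ... | false | _     = refl

count-∨-≤ : ∀ {m} (f g h : Fin m → Bool) → (∀ i → f i ≡ true → g i ≡ true ⊎ h i ≡ true) →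
            count f ℕ.≤ count g ℕ.+ count h
count-∨-≤ f g h cover = subst (count f ℕ.≤_) (sumℕ-+ (b2n ∘ g) (b2n ∘ h)) (sumℕ-mono pointwise)
  where
  pointwise : ∀ i → b2n (f i) ℕ.≤ b2n (g i) ℕ.+ b2n (h i)
  pointwise i with f i in fi
  ... | false = z≤n
  ... | true with cover i fi
  ...   | inj₁ gi rewrite gi = s≤s z≤n
  ...   | inj₂ hi rewrite hi = ℕₚ.m≤n+m 1 (b2n (g i))

least : (ℕ → Bool) → ℕ → ℕ
least f zero    = 0
least f (suc N) = if f 0 then 0 else suc (least (f ∘ suc) N)

least-true : ∀ (f : ℕ → Bool) N → f N ≡ true → f (least f N) ≡ true
least-true f zero    fN = fN
least-true f (suc N) fN with f 0 in f0
... | true  = f0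
... | false = least-true (f ∘ suc) N fN

least-minimal : ∀ (f : ℕ → Bool) N k → k ℕ.< least f N → f k ≡ false
least-minimal f (suc N) k k< with f 0 in f0
least-minimal f (suc N) zero    k< | false = f0
least-minimal f (suc N) (suc k) k< | false = least-minimal (f ∘ suc) N k (ℕ.s≤s⁻¹ k<)

least-≤ : ∀ (f : ℕ → Bool) N → least f N ℕ.≤ N
least-≤ f zero    = z≤n
least-≤ f (suc N) with f 0
... | true  = z≤n
... | false = s≤s (least-≤ (f ∘ suc) N)

b2z≡+b2n : ∀ b → b2z b ≡ + b2n b
b2z≡+b2n true  = refl
b2z≡+b2n false = refl

sumℤ-cong : ∀ {m} {f g : Fin m → ℤ} → (∀ i → f i ≡ g i) → sumℤ f ≡ sumℤ g
sumℤ-cong {zero}  eq = refl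
sumℤ-cong {suc m} eq = cong₂ ℤ._+_ (eq zero) (sumℤ-cong (eq ∘ suc))

sumℤ-+ : ∀ {m} (f g : Fin m → ℤ) → sumℤ (λ i → f i ℤ.+ g i) ≡ sumℤ f ℤ.+ sumℤ g
sumℤ-+ {zero}  f g = refl
sumℤ-+ {suc m} f g = trans (cong (ℤ._+_ (f zero ℤ.+ g zero)) (sumℤ-+ (f ∘ suc) (g ∘ suc)))
                           (ℤ-interchange (f zero) (g zero) _ _)

sumℤ-neg : ∀ {m} (f : Fin m → ℤ) → sumℤ (λ i → ℤ.- f i) ≡ ℤ.- sumℤ f
sumℤ-neg {zero}  f = refl
sumℤ-neg {suc m} f = trans (cong (ℤ._+_ (ℤ.- f zero)) (sumℤ-neg (f ∘ suc)))
                           (sym (ℤₚ.neg-distrib-+ (f zero) _))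

sumℤ-*ˡ : ∀ {m} c (f : Fin m → ℤ) → sumℤ (λ i → c ℤ.* f i) ≡ c ℤ.* sumℤ f
sumℤ-*ˡ {zero}  c f = sym (ℤₚ.*-zeroʳ c)
sumℤ-*ˡ {suc m} c f = trans (cong (ℤ._+_ (c ℤ.* f zero)) (sumℤ-*ˡ c (f ∘ suc)))
                            (sym (ℤₚ.*-distribˡ-+ c (f zero) _))

sumℤ-mono : ∀ {m} {f g : Fin m → ℤ} → (∀ i → f i ℤ.≤ g i) → sumℤ f ℤ.≤ sumℤ g
sumℤ-mono {zero}  le = ℤₚ.≤-refl
sumℤ-mono {suc m} le = ℤₚ.+-mono-≤ (le zero) (sumℤ-mono (le ∘ suc))

sumℤ-zeros : ∀ m → sumℤ {m} (λ _ → 0ℤ) ≡ 0ℤ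
sumℤ-zeros zero    = refl
sumℤ-zeros (suc m) = trans (ℤₚ.+-identityˡ _) (sumℤ-zeros m)

sumℤ-nonpos : ∀ {m} (f : Fin m → ℤ) → (∀ i → f i ℤ.≤ 0ℤ) → sumℤ f ℤ.≤ 0ℤ
sumℤ-nonpos {m} f le = subst (sumℤ f ℤ.≤_) (sumℤ-zeros m) (sumℤ-mono le)

sumℤ-count : ∀ {m} (f : Fin m → Bool) → sumℤ (b2z ∘ f) ≡ + count f
sumℤ-count {zero}  f = refl
sumℤ-count {suc m} f = trans (cong₂ ℤ._+_ (b2z≡+b2n (f zero)) (sumℤ-count (f ∘ suc)))
                             (sym (ℤₚ.pos-+ (b2n (f zero)) _))

sumℤ-δ : ∀ {m} k (f : Fin m → ℤ) → sumℤ (λ i → if does (k Fin.≟ i) then f i else 0ℤ) ≡ f k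
sumℤ-δ {suc m} zero f = trans (cong (ℤ._+_ (f zero)) (sumℤ-zeros m)) (ℤₚ.+-identityʳ (f zero))
sumℤ-δ {suc m} (suc k) f = trans (ℤₚ.+-identityˡ _) (trans (sumℤ-cong shift) (sumℤ-δ k (f ∘ suc)))
  where
  shift : ∀ i → (if does (suc k Fin.≟ suc i) then f (suc i) else 0ℤ) ≡
                (if does (k Fin.≟ i) then f (suc i) else 0ℤ)
  shift i with k Fin.≟ i
  ... | yes refl = refl
  ... | no _     = refl

module Laplacian {m} (adj : Fin (suc m) → Fin (suc m) → Bool) (loopless : ∀ u → adj u u ≡ false) where

  open ℤ-Solver.+-*-Solver

  A : Fin m → Fin m → ℤ
  A a b = b2z (adj (suc a) (suc b))

  private
    diagonal-split : ∀ Y a b →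
      laplacian adj (suc a) (suc b) ℤ.* indicator Y b ≡
      (if does (a Fin.≟ b) then degree adj (suc a) ℤ.* indicator Y b else 0ℤ) ℤ.- A a b ℤ.* indicator Y b
    diagonal-split Y a b with suc a Fin.≟ suc b | a Fin.≟ b
    ... | yes _  | yes refl rewrite loopless (suc a) =
      solve 2 (λ d y → d :* y := d :* y :- con 0ℤ :* y) refl (degree adj (suc a)) (indicator Y a)
    ... | yes eq | no a≢b  = ⊥-elim (a≢b (Finₚ.suc-injective eq))
    ... | no sa≢sb | yes refl = ⊥-elim (sa≢sb refl)
    ... | no _   | no _    = solve 2 (λ x y → :- x :* y := con 0ℤ :- x :* y) refl (A a b) (indicator Y b)

  -- The degree still counts the edge to the sink, whose column has been removed.
  reducedLapInd-expand : ∀ Y a → reducedLapInd adj Y a ≡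
    b2z (adj (suc a) zero) ℤ.* indicator Y a ℤ.+ sumℤ (λ b → A a b ℤ.* (indicator Y a ℤ.- indicator Y b))
  reducedLapInd-expand Y a = begin
    reducedLapInd adj Y a
      ≡⟨ sumℤ-cong (diagonal-split Y a) ⟩
    sumℤ (λ b → (if does (a Fin.≟ b) then degree adj (suc a) ℤ.* y b else 0ℤ) ℤ.- A a b ℤ.* y b)
      ≡⟨ sumℤ-+ (λ b → if does (a Fin.≟ b) then degree adj (suc a) ℤ.* y b else 0ℤ) (λ b → ℤ.- (A a b ℤ.* y b)) ⟩
    sumℤ (λ b → if does (a Fin.≟ b) then degree adj (suc a) ℤ.* y b else 0ℤ) ℤ.+ sumℤ (λ b → ℤ.- (A a b ℤ.* y b))
      ≡⟨ cong₂ ℤ._+_ (sumℤ-δ a (λ b → degree adj (suc a) ℤ.* y b)) (sumℤ-neg (λ b → A a b ℤ.* y b)) ⟩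
    (A₀ ℤ.+ sumℤ (A a)) ℤ.* y a ℤ.- sumℤ (λ b → A a b ℤ.* y b)
      ≡⟨ solve 4 (λ A₀ S ya T → (A₀ :+ S) :* ya :- T := A₀ :* ya :+ (ya :* S :- T)) refl
               A₀ (sumℤ (A a)) (y a) (sumℤ (λ b → A a b ℤ.* y b)) ⟩
    A₀ ℤ.* y a ℤ.+ (y a ℤ.* sumℤ (A a) ℤ.- sumℤ (λ b → A a b ℤ.* y b))
      ≡⟨ cong (ℤ._+_ (A₀ ℤ.* y a)) (cong₂ ℤ._+_ (sym (sumℤ-*ˡ (y a) (A a))) (sym (sumℤ-neg (λ b → A a b ℤ.* y b)))) ⟩
    A₀ ℤ.* y a ℤ.+ (sumℤ (λ b → y a ℤ.* A a b) ℤ.+ sumℤ (λ b → ℤ.- (A a b ℤ.* y b)))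
      ≡⟨ cong (ℤ._+_ (A₀ ℤ.* y a)) (sym (sumℤ-+ (λ b → y a ℤ.* A a b) (λ b → ℤ.- (A a b ℤ.* y b)))) ⟩
    A₀ ℤ.* y a ℤ.+ sumℤ (λ b → y a ℤ.* A a b ℤ.- A a b ℤ.* y b)
      ≡⟨ cong (ℤ._+_ (A₀ ℤ.* y a)) (sumℤ-cong (λ b →
           solve 3 (λ ya x yb → ya :* x :- x :* yb := x :* (ya :- yb)) refl (y a) (A a b) (y b))) ⟩
    A₀ ℤ.* y a ℤ.+ sumℤ (λ b → A a b ℤ.* (y a ℤ.- y b)) ∎
    where
    open ≡-Reasoning
    A₀ = b2z (adj (suc a) zero)
    y = indicator Y

  reducedLapInd-outside : ∀ Y a → lookup Y a ≡ false → reducedLapInd adj Y a ℤ.≤ 0ℤ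
  reducedLapInd-outside Y a a∉Y = begin
    reducedLapInd adj Y a
      ≡⟨ reducedLapInd-expand Y a ⟩
    b2z (adj (suc a) zero) ℤ.* indicator Y a ℤ.+ sumℤ (λ b → A a b ℤ.* (indicator Y a ℤ.- indicator Y b))
      ≡⟨ cong (λ y → b2z (adj (suc a) zero) ℤ.* b2z y ℤ.+ sumℤ (λ b → A a b ℤ.* (b2z y ℤ.- indicator Y b))) a∉Y ⟩
    b2z (adj (suc a) zero) ℤ.* 0ℤ ℤ.+ sumℤ (λ b → A a b ℤ.* (0ℤ ℤ.- indicator Y b))
      ≡⟨ trans (cong (ℤ._+ sumℤ (λ b → A a b ℤ.* (0ℤ ℤ.- indicator Y b))) (ℤₚ.*-zeroʳ (b2z (adj (suc a) zero)))) (ℤₚ.+-identityˡ _) ⟩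
    sumℤ (λ b → A a b ℤ.* (0ℤ ℤ.- indicator Y b))
      ≤⟨ sumℤ-nonpos (λ b → A a b ℤ.* (0ℤ ℤ.- indicator Y b)) (λ b → nonpos (adj (suc a) (suc b)) (lookup Y b)) ⟩
    0ℤ ∎
    where
    open ℤₚ.≤-Reasoning
    nonpos : ∀ e y → b2z e ℤ.* (0ℤ ℤ.- b2z y) ℤ.≤ 0ℤ
    nonpos false y     = ℤₚ.≤-refl
    nonpos true  false = ℤₚ.≤-refl
    nonpos true  true  = ℤ.-≤+

  reducedLapInd-inside : ∀ Y a → lookup Y a ≡ true → reducedLapInd adj Y a ≡
    b2z (adj (suc a) zero) ℤ.+ + count (λ b → adj (suc a) (suc b) ∧ not (lookup Y b))
  reducedLapInd-inside Y a a∈Y = begin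
    reducedLapInd adj Y a
      ≡⟨ reducedLapInd-expand Y a ⟩
    b2z (adj (suc a) zero) ℤ.* indicator Y a ℤ.+ sumℤ (λ b → A a b ℤ.* (indicator Y a ℤ.- indicator Y b))
      ≡⟨ cong (λ y → b2z (adj (suc a) zero) ℤ.* b2z y ℤ.+ sumℤ (λ b → A a b ℤ.* (b2z y ℤ.- indicator Y b))) a∈Y ⟩
    b2z (adj (suc a) zero) ℤ.* 1ℤ ℤ.+ sumℤ (λ b → A a b ℤ.* (1ℤ ℤ.- indicator Y b))
      ≡⟨ cong₂ ℤ._+_ (ℤₚ.*-identityʳ (b2z (adj (suc a) zero))) (sumℤ-cong (λ b → term (adj (suc a) (suc b)) (lookup Y b))) ⟩
    b2z (adj (suc a) zero) ℤ.+ sumℤ (λ b → b2z (adj (suc a) (suc b) ∧ not (lookup Y b)))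
      ≡⟨ cong (ℤ._+_ (b2z (adj (suc a) zero))) (sumℤ-count (λ b → adj (suc a) (suc b) ∧ not (lookup Y b))) ⟩
    b2z (adj (suc a) zero) ℤ.+ + count (λ b → adj (suc a) (suc b) ∧ not (lookup Y b)) ∎
    where
    open ≡-Reasoning
    term : ∀ e y → b2z e ℤ.* (1ℤ ℤ.- b2z y) ≡ b2z (e ∧ not y)
    term false y     = refl
    term true  false = refl
    term true  true  = refl

-- Superstability on K(G) versus superstability on G

module Cone {n} (G : SimpleGraph n) where

  open ℤ-Solver.+-*-Solver

  Kadj-loopless : ∀ u → Kadj G u u ≡ false
  Kadj-loopless zero    = refl
  Kadj-loopless (suc u) = loopless G u

  module LG = Laplacian (adj G) (loopless G)
  module LK = Laplacian (Kadj G) Kadj-loopless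

  reducedLapInd-cone : ∀ Y a →
    reducedLapInd (Kadj G) (false ∷ Y) (suc a) ≡ indicator Y a ℤ.+ reducedLapInd (adj G) Y a
  reducedLapInd-cone Y a = begin
    reducedLapInd (Kadj G) (false ∷ Y) (suc a)
      ≡⟨ LK.reducedLapInd-expand (false ∷ Y) (suc a) ⟩
    1ℤ ℤ.* y ℤ.+ (A₀ ℤ.* (y ℤ.- 0ℤ) ℤ.+ S)
      ≡⟨ solve 3 (λ y A₀ S → con 1ℤ :* y :+ (A₀ :* (y :- con 0ℤ) :+ S) := y :+ (A₀ :* y :+ S)) refl y A₀ S ⟩
    y ℤ.+ (A₀ ℤ.* y ℤ.+ S)
      ≡⟨ cong (ℤ._+_ y) (sym (LG.reducedLapInd-expand Y a)) ⟩
    y ℤ.+ reducedLapInd (adj G) Y a ∎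
    where
    open ≡-Reasoning
    y  = indicator Y a
    A₀ = b2z (adj G (suc a) zero)
    S  = sumℤ (λ b → LG.A a b ℤ.* (y ℤ.- indicator Y b))

  private
    1≰0 : ∀ {u} → 1ℤ ℤ.≤ u → u ℤ.≤ 0ℤ → ⊥
    1≰0 p q with ℤₚ.≤-trans p q
    ... | ℤ.+≤+ ()

    lookup-addOnes : ∀ {k} (c : Vec ℤ k) a → lookup (addOnes c) a ≡ lookup c a ℤ.+ 1ℤ
    lookup-addOnes (x ∷ c) zero    = refl
    lookup-addOnes (x ∷ c) (suc a) = lookup-addOnes c a

    v₀∈Y-unstable : ∀ Y → 1ℤ ℤ.≤ reducedLapInd (Kadj G) (true ∷ Y) zero
    v₀∈Y-unstable Y rewrite LK.reducedLapInd-inside (true ∷ Y) zero refl = ℤ.+≤+ (s≤s z≤n)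

  -- Every firing set of the cone configuration must avoid v₀, which holds no chip;
  -- on the other vertices K(G) fires like G, offset by the extra chip and the extra edge.
  superstable-cone : ∀ c → Superstable (adj G) c → Superstable (Kadj G) (addOnes (-1ℤ ∷ c))
  superstable-cone c (c≥0 , stable) = nonneg , cone-stable
    where
    nonneg : ∀ a → 0ℤ ℤ.≤ lookup (addOnes (-1ℤ ∷ c)) a
    nonneg zero    = ℤₚ.≤-refl
    nonneg (suc a) = subst (0ℤ ℤ.≤_) (sym (lookup-addOnes c a))
                           (ℤₚ.≤-trans (c≥0 a) (ℤₚ.i≤i+j (lookup c a) 1ℤ))
    cone-stable : ∀ Y → Nonempty Y → ¬ (∀ a → 0ℤ ℤ.≤ lookup (addOnes (-1ℤ ∷ c)) a ℤ.- reducedLapInd (Kadj G) Y a)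
    cone-stable (true ∷ Y) _ legal = 1≰0 (v₀∈Y-unstable Y) (ℤₚ.0≤i-j⇒j≤i (legal zero))
    cone-stable (false ∷ Y) (suc a₀ , Data.Vec.there a₀∈Y) legal = stable Y (a₀ , a₀∈Y) legalG
      where
      legalG : ∀ a → 0ℤ ℤ.≤ lookup c a ℤ.- reducedLapInd (adj G) Y a
      legalG a with lookup Y a in a∈?Y
      ... | false = ℤₚ.i≤j⇒0≤j-i (ℤₚ.≤-trans (LG.reducedLapInd-outside Y a a∈?Y) (c≥0 a))
      ... | true  = subst (0ℤ ℤ.≤_) shift (legal (suc a))
        where
        shift : lookup (addOnes c) a ℤ.- reducedLapInd (Kadj G) (false ∷ Y) (suc a) ≡
                lookup c a ℤ.- reducedLapInd (adj G) Y a
        shift rewrite lookup-addOnes c a | reducedLapInd-cone Y a | a∈?Y =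
          solve 2 (λ x L → (x :+ con 1ℤ) :- (con 1ℤ :+ L) := x :- L) refl (lookup c a) (reducedLapInd (adj G) Y a)

  superstable-uncone : ∀ c → Superstable (Kadj G) (addOnes (-1ℤ ∷ c)) → (∀ a → 0ℤ ℤ.≤ lookup c a) →
                       Superstable (adj G) c
  superstable-uncone c (_ , cone-stable) c≥0 = c≥0 , stable
    where
    stable : ∀ Y → Nonempty Y → ¬ (∀ a → 0ℤ ℤ.≤ lookup c a ℤ.- reducedLapInd (adj G) Y a)
    stable Y (a₀ , a₀∈Y) legalG = cone-stable (false ∷ Y) (suc a₀ , Data.Vec.there a₀∈Y) legal
      where
      legal : ∀ a → 0ℤ ℤ.≤ lookup (addOnes (-1ℤ ∷ c)) a ℤ.- reducedLapInd (Kadj G) (false ∷ Y) a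
      legal zero    = ℤₚ.i≤j⇒0≤j-i (LK.reducedLapInd-outside (false ∷ Y) zero refl)
      legal (suc a) = subst (0ℤ ℤ.≤_) (sym shift) (ℤₚ.+-mono-≤ (legalG a) (ℤₚ.i≤j⇒0≤j-i (b2z≤1 (lookup Y a))))
        where
        b2z≤1 : ∀ b → b2z b ℤ.≤ 1ℤ
        b2z≤1 true  = ℤₚ.≤-refl
        b2z≤1 false = ℤ.+≤+ z≤n
        shift : lookup (addOnes c) a ℤ.- reducedLapInd (Kadj G) (false ∷ Y) (suc a) ≡
                (lookup c a ℤ.- reducedLapInd (adj G) Y a) ℤ.+ (1ℤ ℤ.- indicator Y a)
        shift rewrite lookup-addOnes c a | reducedLapInd-cone Y a =
          solve 3 (λ x L y → (x :+ con 1ℤ) :- (y :+ L) := (x :- L) :+ (con 1ℤ :- y)) refl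
                (lookup c a) (reducedLapInd (adj G) Y a) (indicator Y a)

  InS̃₀⇔superstable : ∀ d → InS̃₀ G d ⇔ (∃[ c ] (Superstable (adj G) c × d ≡ -1ℤ ∷ c))
  InS̃₀⇔superstable d = mk⇔ to from
    where
    to : ∀ {d} → InS̃₀ G d → ∃[ c ] (Superstable (adj G) c × d ≡ -1ℤ ∷ c)
    to {d₀ ∷ c} (d∈S , refl , d+v₀≥0) = c , superstable-uncone c d∈S (d+v₀≥0 ∘ suc) , refl
    from : ∀ {d} → ∃[ c ] (Superstable (adj G) c × d ≡ -1ℤ ∷ c) → InS̃₀ G d
    from (c , c-superstable , refl) = superstable-cone c c-superstable , refl , nonneg
      where
      nonneg : ∀ v → 0ℤ ℤ.≤ lookup (addVertex (-1ℤ ∷ c) zero) v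
      nonneg zero    = ℤₚ.≤-refl
      nonneg (suc a) = proj₁ c-superstable a

-- Regions of the semiorder arrangement and the closed form of λ₀

module Arrangement {n} (G : SimpleGraph n) where

  edge : Fin n → Fin n → Bool
  edge i j = adj G (suc i) (suc j)

  above? : Pt n → Fin n → Fin n → Bool
  above? x i j = does (1ℚ ℚₚ.<? (x i ℚ.- x j))

  jump : Pt n → Fin n → Fin n → Bool
  jump x i j = edge i j ∧ above? x i j

  jumps : Pt n → Fin n → ℕ
  jumps x i = count (jump x i)

  height : Pt n → ℕ
  height x = sumℕ (jumps x)

  sinkOffset : Fin n → ℤ
  sinkOffset a = if adj G zero (suc a) then 0ℤ else -1ℤ

  canonicalLabelAt : Pt n → Fin (suc n) → ℤ
  canonicalLabelAt x zero    = -1ℤ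
  canonicalLabelAt x (suc a) = sinkOffset a ℤ.+ + jumps x a

  canonicalLabel : Pt n → Divisor n
  canonicalLabel x = tabulate (canonicalLabelAt x)

  above?-true : ∀ x i j → Above x i j → above? x i j ≡ true
  above?-true x i j = dec-true (1ℚ ℚₚ.<? (x i ℚ.- x j))

  above?-false : ∀ x i j → Below x i j → above? x i j ≡ false
  above?-false x i j below = dec-false (1ℚ ℚₚ.<? (x i ℚ.- x j)) (ℚₚ.<-asym below)

  above?-sound : ∀ x i j → above? x i j ≡ true → Above x i j
  above?-sound x i j = dec-true⁻¹ (1ℚ ℚₚ.<? (x i ℚ.- x j))

  above⇒¬below : ∀ (x : Pt n) i j → Above x i j → ¬ Below x i j
  above⇒¬below x i j = ℚₚ.<-asym

  ≤⇒below : ∀ (x : Pt n) a b → x a ℚ.≤ x b → Below x a b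
  ≤⇒below x a b xa≤xb = ℚₚ.≤-<-trans (subst (x a ℚ.- x b ℚ.≤_) (ℚₚ.+-inverseʳ (x b)) (ℚₚ.+-monoˡ-≤ (ℚ.- x b) xa≤xb))
                                     (ℚₚ.positive⁻¹ 1ℚ)

  side : ∀ x → Generic G x → ∀ i j → HP G i j → Above x i j ⊎ Below x i j
  side x x-generic i j ij with ℚₚ.<-cmp (x i ℚ.- x j) 1ℚ
  ... | tri< below _ _ = inj₂ below
  ... | tri≈ _ on _    = ⊥-elim (x-generic i j ij on)
  ... | tri> _ _ above = inj₁ above

  edge-irrefl : ∀ i j → HP G i j → i ≢ j
  edge-irrefl i .i ii refl = true≢false (trans (sym ii) (loopless G (suc i)))

  edge-sym : ∀ i j → HP G i j → HP G j i
  edge-sym i j ij = trans (symmetric G (suc j) (suc i)) ij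

  jump-true : ∀ x i j → HP G i j → Above x i j → jump x i j ≡ true
  jump-true x i j ij above rewrite ij = above?-true x i j above

  jump-sound : ∀ x i j → jump x i j ≡ true → HP G i j × Above x i j
  jump-sound x i j jmp with ∧-true⁻¹ {edge i j} jmp
  ... | ij , above = ij , above?-sound x i j above

  jump-cong : ∀ x y → Generic G x → Generic G y → ∀ k l →
              (HP G k l → (Below y k l ⇔ Below x k l)) → jump x k l ≡ jump y k l
  jump-cong x y x-generic y-generic k l same = ∧-congˡ (edge k l) same-side
    where
    ∧-congˡ : ∀ b {u v} → (b ≡ true → u ≡ v) → b ∧ u ≡ b ∧ v
    ∧-congˡ true  eq = eq refl
    ∧-congˡ false eq = refl
    same-side : HP G k l → above? x k l ≡ above? y k l
    same-side kl with side y y-generic k l kl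
    ... | inj₂ below-y = trans (above?-false x k l (Equivalence.to (same kl) below-y)) (sym (above?-false y k l below-y))
    ... | inj₁ above-y with side x x-generic k l kl
    ...   | inj₁ above-x = trans (above?-true x k l above-x) (sym (above?-true y k l above-y))
    ...   | inj₂ below-x = ⊥-elim (above⇒¬below y k l above-y (Equivalence.from (same kl) below-x))

  record Crossing (y x : Pt n) (i j : Fin n) : Set where
    constructor crossing
    field
      edge-ij   : HP G i j
      below-y   : Below y i j
      above-x   : Above x i j
      unchanged : ∀ k l → HP G k l → ¬ (k ≡ i × l ≡ j) → (Below y k l ⇔ Below x k l)

  crossing⇒border : ∀ {x y i j} → Crossing y x i j → Border G y x
  crossing⇒border {i = i} {j} (crossing ij below above others) = i , j , ij , inj₁ (below , above) , others

  border⇒crossing : ∀ x y → Border G y x → (∃[ i ] ∃[ j ] Crossing y x i j) ⊎ (∃[ i ] ∃[ j ] Crossing x y i j)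
  border⇒crossing x y (i , j , ij , inj₁ (below , above) , others) = inj₁ (i , j , crossing ij below above others)
  border⇒crossing x y (i , j , ij , inj₂ (above , below) , others) =
    inj₂ (i , j , crossing ij below above λ k l kl ne → ⇔.sym (others k l kl ne))

  module Crossed {x y : Pt n} {i j : Fin n} (cross : Crossing y x i j)
                 (x-generic : Generic G x) (y-generic : Generic G y) where

    open Crossing cross

    jumps-uncrossed : ∀ k → k ≢ i → jumps x k ≡ jumps y k
    jumps-uncrossed k k≢i = count-cong (λ l → jump-cong x y x-generic y-generic k l
                                                 (λ kl → unchanged k l kl (k≢i ∘ proj₁)))

    jumps-crossed : jumps x i ≡ suc (jumps y i)
    jumps-crossed = count-suc-at j
      (λ l l≢j → sym (jump-cong x y x-generic y-generic i l (λ il → unchanged i l il (l≢j ∘ proj₂))))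
      (subst (λ e → e ∧ above? y i j ≡ false) (sym edge-ij) (above?-false y i j below-y))
      (jump-true x i j edge-ij above-x)

    height-crossed : height x ≡ suc (height y)
    height-crossed = sumℕ-suc-at i (λ k k≢i → sym (jumps-uncrossed k k≢i)) jumps-crossed

    canonicalLabel-crossed : canonicalLabel x ≡ addVertex (canonicalLabel y) (suc i)
    canonicalLabel-crossed = lookup-ext _ _ at
      where
      at : ∀ u → lookup (canonicalLabel x) u ≡ lookup (addVertex (canonicalLabel y) (suc i)) u
      at zero = begin
        lookup (canonicalLabel x) zero                        ≡⟨ Vecₚ.lookup∘tabulate (canonicalLabelAt x) zero ⟩
        -1ℤ                                                   ≡⟨ Vecₚ.lookup∘tabulate (canonicalLabelAt y) zero ⟨
        lookup (canonicalLabel y) zero                        ≡⟨ Vecₚ.lookup∘updateAt′ zero (suc i) {ℤ._+ 1ℤ} (λ ()) (canonicalLabel y) ⟨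
        lookup (addVertex (canonicalLabel y) (suc i)) zero    ∎
        where open ≡-Reasoning
      at (suc k) with k Fin.≟ i
      ... | yes refl = begin
        lookup (canonicalLabel x) (suc i)                     ≡⟨ Vecₚ.lookup∘tabulate (canonicalLabelAt x) (suc i) ⟩
        sinkOffset i ℤ.+ + jumps x i                          ≡⟨ cong (λ m → sinkOffset i ℤ.+ + m) (trans jumps-crossed (ℕₚ.+-comm 1 (jumps y i))) ⟩
        sinkOffset i ℤ.+ (+ jumps y i ℤ.+ 1ℤ)                 ≡⟨ ℤₚ.+-assoc (sinkOffset i) (+ jumps y i) 1ℤ ⟨
        canonicalLabelAt y (suc i) ℤ.+ 1ℤ                     ≡⟨ cong (ℤ._+ 1ℤ) (Vecₚ.lookup∘tabulate (canonicalLabelAt y) (suc i)) ⟨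
        lookup (canonicalLabel y) (suc i) ℤ.+ 1ℤ              ≡⟨ Vecₚ.lookup∘updateAt (suc i) (canonicalLabel y) ⟨
        lookup (addVertex (canonicalLabel y) (suc i)) (suc i) ∎
        where open ≡-Reasoning
      ... | no k≢i = begin
        lookup (canonicalLabel x) (suc k)                     ≡⟨ Vecₚ.lookup∘tabulate (canonicalLabelAt x) (suc k) ⟩
        sinkOffset k ℤ.+ + jumps x k                          ≡⟨ cong (λ m → sinkOffset k ℤ.+ + m) (jumps-uncrossed k k≢i) ⟩
        canonicalLabelAt y (suc k)                            ≡⟨ Vecₚ.lookup∘tabulate (canonicalLabelAt y) (suc k) ⟨
        lookup (canonicalLabel y) (suc k)                     ≡⟨ Vecₚ.lookup∘updateAt′ (suc k) (suc i) {ℤ._+ 1ℤ} (k≢i ∘ Finₚ.suc-injective) (canonicalLabel y) ⟨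
        lookup (addVertex (canonicalLabel y) (suc i)) (suc k) ∎
        where open ≡-Reasoning

  jumps-central : ∀ x → Central G x → ∀ a → jumps x a ≡ 0
  jumps-central x central a = count-zero (jump x a) no-jump
    where
    no-jump : ∀ l → jump x a l ≡ false
    no-jump l with edge a l in al
    ... | false = refl
    ... | true  = above?-false x a l (central a l al)

  height-central : ∀ x → Central G x → height x ≡ 0
  height-central x central = sumℕ-zero (jumps x) (jumps-central x central)

  canonicalLabel-central : ∀ x → Central G x → canonicalLabel x ≡ baseLabel G
  canonicalLabel-central x central = Vecₚ.tabulate-cong at
    where
    at : ∀ u → canonicalLabelAt x u ≡ (if adj G zero u then 0ℤ else -1ℤ)
    at zero    rewrite loopless G zero = refl
    at (suc a) rewrite jumps-central x central a = ℤₚ.+-identityʳ (sinkOffset a)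

  height≡0⇒central : ∀ x → Generic G x → height x ≡ 0 → Central G x
  height≡0⇒central x x-generic h≡0 i j ij with side x x-generic i j ij
  ... | inj₂ below = below
  ... | inj₁ above = ⊥-elim (true≢false (trans (sym (jump-true x i j ij above))
                                               (count≡0⇒ (jump x i) (sumℕ≡0⇒ (jumps x) h≡0 i) j)))

  reach⇒height≤ : ∀ k x → Generic G x → Reach G k x → height x ℕ.≤ k
  reach⇒height≤ zero    x _ central = ℕₚ.≤-reflexive (height-central x central)
  reach⇒height≤ (suc k) x x-generic (inj₁ reach) = ℕₚ.m≤n⇒m≤1+n (reach⇒height≤ k x x-generic reach)
  reach⇒height≤ (suc k) x x-generic (inj₂ (y , y-generic , reach , border)) with border⇒crossing x y border
  ... | inj₁ (i , j , cross) = subst (ℕ._≤ suc k) (sym (Crossed.height-crossed cross x-generic y-generic))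
                                     (s≤s (reach⇒height≤ k y y-generic reach))
  ... | inj₂ (i , j , cross) = ℕₚ.m≤n⇒m≤1+n (ℕₚ.≤-trans (ℕₚ.n≤1+n (height x))
          (subst (ℕ._≤ k) (Crossed.height-crossed cross y-generic x-generic) (reach⇒height≤ k y y-generic reach)))

-- Descending from a region towards the central region

module _ {c ℓ₁ ℓ₂} (O : TotalPreorder c ℓ₁ ℓ₂) where
  open TotalPreorder O using (Carrier; _≲_) renaming (refl to ≲-refl; trans to ≲-trans; total to ≲-total)

  argmin : ∀ {m} (P : Fin m → Bool) (key : Fin m → Carrier) → ∃[ k ] P k ≡ true →
           ∃[ k ] (P k ≡ true × (∀ j → P j ≡ true → key k ≲ key j))
  argmin {suc m} P key (k₀ , pk₀) with Finₚ.any? (λ k → P (suc k) Boolₚ.≟ true)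
  ... | no none = zero , p₀ k₀ pk₀ , minimal
    where
    p₀ : ∀ k → P k ≡ true → P zero ≡ true
    p₀ zero    pk = pk
    p₀ (suc k) pk = ⊥-elim (none (k , pk))
    minimal : ∀ j → P j ≡ true → key zero ≲ key j
    minimal zero    _  = ≲-refl
    minimal (suc j) pj = ⊥-elim (none (j , pj))
  ... | yes w with argmin (P ∘ suc) (key ∘ suc) w
  ...   | k , pk , minimal with P zero in p₀
  ...     | false = suc k , pk , minimal′
    where
    minimal′ : ∀ j → P j ≡ true → key (suc k) ≲ key j
    minimal′ zero    pj = ⊥-elim (true≢false (trans (sym pj) p₀))
    minimal′ (suc j) pj = minimal j pj
  ...     | true with ≲-total (key zero) (key (suc k))
  ...       | inj₁ le = zero , p₀ , minimal′
    where
    minimal′ : ∀ j → P j ≡ true → key zero ≲ key j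
    minimal′ zero    _  = ≲-refl
    minimal′ (suc j) pj = ≲-trans le (minimal j pj)
  ...       | inj₂ ge = suc k , pk , minimal′
    where
    minimal′ : ∀ j → P j ≡ true → key (suc k) ≲ key j
    minimal′ zero    _  = ge
    minimal′ (suc j) pj = minimal j pj

  argmin₂ : ∀ {m k} (P : Fin m → Fin k → Bool) (key : Fin m → Fin k → Carrier) → ∃[ i ] ∃[ j ] P i j ≡ true →
            ∃[ i ] ∃[ j ] (P i j ≡ true × (∀ i′ j′ → P i′ j′ ≡ true → key i j ≲ key i′ j′))
  argmin₂ {m} {k} P key (i₀ , j₀ , p₀)
    with argmin (uncurry P ∘ Fin.remQuot {m} k) (uncurry key ∘ Fin.remQuot {m} k)
                (Fin.combine i₀ j₀ , subst (λ ij → uncurry P ij ≡ true) (sym (Finₚ.remQuot-combine i₀ j₀)) p₀)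
  ... | z , pz , minimal = proj₁ (Fin.remQuot {m} k z) , proj₂ (Fin.remQuot {m} k z) , pz , minimal′
    where
    minimal′ : ∀ i j → P i j ≡ true → uncurry key (Fin.remQuot {m} k z) ≲ key i j
    minimal′ i j pij = subst (λ ij → uncurry key (Fin.remQuot {m} k z) ≲ uncurry key ij) (Finₚ.remQuot-combine i j)
                           (minimal (Fin.combine i j) (subst (λ ij → uncurry P ij ≡ true) (sym (Finₚ.remQuot-combine i j)) pij))

<-by-difference : ∀ a {b} p → b ≡ a ℚ.+ p → 0ℚ ℚ.< p → a ℚ.< b
<-by-difference a p refl 0<p = subst (ℚ._< a ℚ.+ p) (ℚₚ.+-identityʳ a) (ℚₚ.+-monoʳ-< a 0<p)

contraction-factor : ∀ d → 1ℚ ℚ.< d →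
  ∃[ s ] (0ℚ ℚ.< s × s ℚ.< 1ℚ × 1ℚ ℚ.< s ℚ.* d × s ℚ.* d ℚ.- (1ℚ ℚ.- s) ℚ.< 1ℚ)
contraction-factor d 1<d = three ℚ.* r , 0<s , s<1 , 1<sd , sd-shift<1
  where
  open ℚ-Solver.+-*-Solver
  two three D e : ℚ
  two   = 1ℚ ℚ.+ 1ℚ
  three = two ℚ.+ 1ℚ
  D     = two ℚ.* d ℚ.+ 1ℚ
  e     = d ℚ.- 1ℚ

  0<e : 0ℚ ℚ.< e
  0<e = subst (ℚ._< e) (ℚₚ.+-inverseʳ 1ℚ) (ℚₚ.+-monoˡ-< (ℚ.- 1ℚ) 1<d)

  0<1 : 0ℚ ℚ.< 1ℚ
  0<1 = ℚₚ.positive⁻¹ 1ℚ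

  0<D : 0ℚ ℚ.< D
  0<D = ℚₚ.<-trans 0<1 (<-by-difference 1ℚ (e ℚ.+ e ℚ.+ two)
          (solve 1 (λ d → (con 1ℚ :+ con 1ℚ) :* d :+ con 1ℚ
                          := con 1ℚ :+ ((d :- con 1ℚ) :+ (d :- con 1ℚ) :+ (con 1ℚ :+ con 1ℚ))) refl d)
          (ℚₚ.+-mono-< (ℚₚ.+-mono-< 0<e 0<e) (ℚₚ.+-mono-< 0<1 0<1)))

  instance
    D-positive : ℚ.Positive D
    D-positive = ℚ.positive 0<D

  r : ℚ
  r = (ℚ.1/ D) {{ℚₚ.pos⇒nonZero D}}

  instance
    r-positive : ℚ.Positive r
    r-positive = ℚₚ.1/pos⇒pos D

  Dr≡1 : D ℚ.* r ≡ 1ℚ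
  Dr≡1 = ℚₚ.*-inverseʳ D {{ℚₚ.pos⇒nonZero D}}

  scale : ∀ {a b} → a ℚ.< b → a ℚ.* r ℚ.< b ℚ.* r
  scale = ℚₚ.*-monoˡ-<-pos r

  0<s : 0ℚ ℚ.< three ℚ.* r
  0<s = subst (ℚ._< three ℚ.* r) (ℚₚ.*-zeroˡ r) (scale (ℚₚ.positive⁻¹ three))

  s<1 : three ℚ.* r ℚ.< 1ℚ
  s<1 = subst (three ℚ.* r ℚ.<_) Dr≡1 (scale (<-by-difference three (e ℚ.+ e)
          (solve 1 (λ d → (con 1ℚ :+ con 1ℚ) :* d :+ con 1ℚ
                          := ((con 1ℚ :+ con 1ℚ) :+ con 1ℚ) :+ ((d :- con 1ℚ) :+ (d :- con 1ℚ))) refl d)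
          (ℚₚ.+-mono-< 0<e 0<e)))

  1<sd : 1ℚ ℚ.< three ℚ.* r ℚ.* d
  1<sd = subst₂ ℚ._<_ Dr≡1 (solve 2 (λ d r → ((con 1ℚ :+ con 1ℚ) :+ con 1ℚ) :* d :* r
                                         := ((con 1ℚ :+ con 1ℚ) :+ con 1ℚ) :* r :* d) refl d r)
           (scale (<-by-difference D e
             (solve 1 (λ d → ((con 1ℚ :+ con 1ℚ) :+ con 1ℚ) :* d
                             := ((con 1ℚ :+ con 1ℚ) :* d :+ con 1ℚ) :+ (d :- con 1ℚ)) refl d)
             0<e))

  sd-shift<1 : three ℚ.* r ℚ.* d ℚ.- (1ℚ ℚ.- three ℚ.* r) ℚ.< 1ℚ
  sd-shift<1 = subst₂ ℚ._<_ lhs rhs (ℚₚ.+-monoˡ-< (ℚ.- 1ℚ) (scale (<-by-difference (three ℚ.* (d ℚ.+ 1ℚ)) e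
                 (solve 1 (λ d → (con 1ℚ :+ con 1ℚ) :* ((con 1ℚ :+ con 1ℚ) :* d :+ con 1ℚ)
                                 := ((con 1ℚ :+ con 1ℚ) :+ con 1ℚ) :* (d :+ con 1ℚ) :+ (d :- con 1ℚ)) refl d)
                 0<e)))
    where
    lhs : three ℚ.* (d ℚ.+ 1ℚ) ℚ.* r ℚ.- 1ℚ ≡ three ℚ.* r ℚ.* d ℚ.- (1ℚ ℚ.- three ℚ.* r)
    lhs = solve 2 (λ d r → ((con 1ℚ :+ con 1ℚ) :+ con 1ℚ) :* (d :+ con 1ℚ) :* r :- con 1ℚ
                         := ((con 1ℚ :+ con 1ℚ) :+ con 1ℚ) :* r :* d :- (con 1ℚ :- ((con 1ℚ :+ con 1ℚ) :+ con 1ℚ) :* r)) refl d r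
    rhs : two ℚ.* D ℚ.* r ℚ.- 1ℚ ≡ 1ℚ
    rhs = begin
      two ℚ.* D ℚ.* r ℚ.- 1ℚ   ≡⟨ cong (ℚ._- 1ℚ) (trans (ℚₚ.*-assoc two D r) (cong (two ℚ.*_) Dr≡1)) ⟩
      two ℚ.* 1ℚ ℚ.- 1ℚ        ≡⟨ solve 0 ((con 1ℚ :+ con 1ℚ) :* con 1ℚ :- con 1ℚ := con 1ℚ) refl ⟩
      1ℚ                       ∎
      where open ≡-Reasoning

module Descent {n} (G : SimpleGraph n) where
  open Arrangement G

  -- (i, j) is a jump of least length d = x_i − x_j; y is obtained from x by contracting
  -- with the factor s of contraction-factor d and lifting x_j, and every coordinate
  -- above it other than x_i, by 1 − s.  Contraction keeps all other sides (jumps have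
  -- length ≥ d and sd > 1); the lift can only undo the jump (i, j).
  module Step (x : Pt n) (x-generic : Generic G x) (i j : Fin n) (ij-jump : jump x i j ≡ true)
              (shortest : ∀ k l → jump x k l ≡ true → x i ℚ.- x j ℚ.≤ x k ℚ.- x l)
              (factor : ∃[ s ] (0ℚ ℚ.< s × s ℚ.< 1ℚ × 1ℚ ℚ.< s ℚ.* (x i ℚ.- x j) ×
                                s ℚ.* (x i ℚ.- x j) ℚ.- (1ℚ ℚ.- s) ℚ.< 1ℚ)) where

    ij : HP G i j
    ij = proj₁ (jump-sound x i j ij-jump)

    above-ij : Above x i j
    above-ij = proj₂ (jump-sound x i j ij-jump)

    s : ℚ
    s = proj₁ factor

    0<s : 0ℚ ℚ.< s
    0<s = proj₁ (proj₂ factor)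

    s<1 : s ℚ.< 1ℚ
    s<1 = proj₁ (proj₂ (proj₂ factor))

    1<sd : 1ℚ ℚ.< s ℚ.* (x i ℚ.- x j)
    1<sd = proj₁ (proj₂ (proj₂ (proj₂ factor)))

    sd-shift<1 : s ℚ.* (x i ℚ.- x j) ℚ.- (1ℚ ℚ.- s) ℚ.< 1ℚ
    sd-shift<1 = proj₂ (proj₂ (proj₂ (proj₂ factor)))

    instance
      s-positive : ℚ.Positive s
      s-positive = ℚ.positive 0<s

    0≤1-s : 0ℚ ℚ.≤ 1ℚ ℚ.- s
    0≤1-s = ℚₚ.<⇒≤ (subst (ℚ._< 1ℚ ℚ.- s) (ℚₚ.+-inverseʳ s) (ℚₚ.+-monoˡ-< (ℚ.- s) s<1))

    Lifted : Fin n → Set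
    Lifted a = a ≡ j ⊎ (x j ℚ.< x a × a ≢ i)

    lifted? : ∀ a → Dec (Lifted a)
    lifted? a = (a Fin.≟ j) ⊎-dec ((x j ℚₚ.<? x a) ×-dec ¬? (a Fin.≟ i))

    liftBy : ∀ {P : Set} → Dec P → ℚ
    liftBy (yes _) = 1ℚ ℚ.- s
    liftBy (no _)  = 0ℚ

    y : Pt n
    y a = s ℚ.* x a ℚ.+ liftBy (lifted? a)

    y-diff : ∀ a b → y a ℚ.- y b ≡ s ℚ.* (x a ℚ.- x b) ℚ.+ (liftBy (lifted? a) ℚ.- liftBy (lifted? b))
    y-diff a b = solve 5 (λ s xa xb la lb → (s :* xa :+ la) :- (s :* xb :+ lb) := s :* (xa :- xb) :+ (la :- lb))
                         refl s (x a) (x b) (liftBy (lifted? a)) (liftBy (lifted? b))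
      where open ℚ-Solver.+-*-Solver

    lift-diff≤ : ∀ {P Q : Set} (p? : Dec P) (q? : Dec Q) → liftBy p? ℚ.- liftBy q? ℚ.≤ 1ℚ ℚ.- s
    lift-diff≤ (yes _) (yes _) = subst (ℚ._≤ 1ℚ ℚ.- s) (sym (ℚₚ.+-inverseʳ (1ℚ ℚ.- s))) 0≤1-s
    lift-diff≤ (yes _) (no _)  = ℚₚ.≤-reflexive (ℚₚ.+-identityʳ (1ℚ ℚ.- s))
    lift-diff≤ (no _)  (yes _) = ℚₚ.≤-trans (ℚₚ.≤-reflexive (ℚₚ.+-identityˡ _))
                                            (ℚₚ.≤-trans (ℚₚ.neg-antimono-≤ 0≤1-s) 0≤1-s)
    lift-diff≤ (no _)  (no _)  = 0≤1-s

    lift-diff≥0 : ∀ {P Q : Set} (p? : Dec P) (q? : Dec Q) → ¬ (¬ P × Q) → 0ℚ ℚ.≤ liftBy p? ℚ.- liftBy q?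
    lift-diff≥0 (yes _) (yes _) _ = ℚₚ.≤-reflexive (sym (ℚₚ.+-inverseʳ (1ℚ ℚ.- s)))
    lift-diff≥0 (yes _) (no _)  _ = subst (0ℚ ℚ.≤_) (sym (ℚₚ.+-identityʳ (1ℚ ℚ.- s))) 0≤1-s
    lift-diff≥0 (no ¬p) (yes q) ok = ⊥-elim (ok (¬p , q))
    lift-diff≥0 (no _)  (no _)  _ = ℚₚ.≤-refl

    below-kept : ∀ a b → Below x a b → Below y a b
    below-kept a b below = subst (ℚ._< 1ℚ) (sym (y-diff a b)) (begin-strict
      s ℚ.* (x a ℚ.- x b) ℚ.+ (liftBy (lifted? a) ℚ.- liftBy (lifted? b))
        <⟨ ℚₚ.+-mono-<-≤ (ℚₚ.*-monoʳ-<-pos s below) (lift-diff≤ (lifted? a) (lifted? b)) ⟩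
      s ℚ.* 1ℚ ℚ.+ (1ℚ ℚ.- s)
        ≡⟨ solve 1 (λ s → s :* con 1ℚ :+ (con 1ℚ :- s) := con 1ℚ) refl s ⟩
      1ℚ ∎)
      where
      open ℚₚ.≤-Reasoning
      open ℚ-Solver.+-*-Solver

    jump-kept : ∀ a b → jump x a b ≡ true → ¬ (¬ Lifted a × Lifted b) → Above y a b
    jump-kept a b jmp ok = subst (1ℚ ℚ.<_) (sym (y-diff a b)) (begin-strict
      1ℚ                                   <⟨ 1<sd ⟩
      s ℚ.* (x i ℚ.- x j)                  ≤⟨ ℚₚ.*-monoˡ-≤-nonNeg s {{ℚₚ.pos⇒nonNeg s}} (shortest a b jmp) ⟩
      s ℚ.* (x a ℚ.- x b)                  ≡⟨ ℚₚ.+-identityʳ _ ⟨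
      s ℚ.* (x a ℚ.- x b) ℚ.+ 0ℚ           ≤⟨ ℚₚ.+-monoʳ-≤ (s ℚ.* (x a ℚ.- x b)) (lift-diff≥0 (lifted? a) (lifted? b) ok) ⟩
      s ℚ.* (x a ℚ.- x b) ℚ.+ (liftBy (lifted? a) ℚ.- liftBy (lifted? b)) ∎)
      where open ℚₚ.≤-Reasoning

    no-drop-from-below : ∀ a b → jump x a b ≡ true → a ≢ i → ¬ Lifted a → x j ℚ.≤ x b → ⊥
    no-drop-from-below a b jmp a≢i ¬La xj≤xb =
      above⇒¬below x a b (proj₂ (jump-sound x a b jmp)) (≤⇒below x a b (ℚₚ.≤-trans xa≤xj xj≤xb))
      where
      xa≤xj : x a ℚ.≤ x j
      xa≤xj = ℚₚ.≮⇒≥ (λ xj<xa → ¬La (inj₂ (xj<xa , a≢i)))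

    only-ij-dropped : ∀ a b → jump x a b ≡ true → ¬ Lifted a → Lifted b → a ≡ i × b ≡ j
    only-ij-dropped a b jmp ¬La (inj₁ b≡j) with a Fin.≟ i
    ... | yes a≡i = a≡i , b≡j
    ... | no a≢i  = ⊥-elim (no-drop-from-below a b jmp a≢i ¬La (ℚₚ.≤-reflexive (cong x (sym b≡j))))
    only-ij-dropped a b jmp ¬La (inj₂ (xj<xb , _)) with a Fin.≟ i
    ... | yes refl = ⊥-elim (ℚₚ.<-irrefl refl
                       (ℚₚ.<-≤-trans (ℚₚ.+-monoʳ-< (x i) (ℚₚ.neg-antimono-< xj<xb)) (shortest i b jmp)))
    ... | no a≢i   = ⊥-elim (no-drop-from-below a b jmp a≢i ¬La (ℚₚ.<⇒≤ xj<xb))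

    below-ij : Below y i j
    below-ij = subst (ℚ._< 1ℚ) (sym (trans (y-diff i j) (cong₂ (λ u v → s ℚ.* (x i ℚ.- x j) ℚ.+ (u ℚ.- v)) unlifted-i lifted-j)))
                     (subst (ℚ._< 1ℚ) shift sd-shift<1)
      where
      unlifted-i : liftBy (lifted? i) ≡ 0ℚ
      unlifted-i with lifted? i
      ... | no _ = refl
      ... | yes (inj₁ i≡j) = ⊥-elim (edge-irrefl i j ij i≡j)
      ... | yes (inj₂ (_ , i≢i)) = ⊥-elim (i≢i refl)
      lifted-j : liftBy (lifted? j) ≡ 1ℚ ℚ.- s
      lifted-j with lifted? j
      ... | yes _ = refl
      ... | no ¬Lj = ⊥-elim (¬Lj (inj₁ refl))
      shift : s ℚ.* (x i ℚ.- x j) ℚ.- (1ℚ ℚ.- s) ≡ s ℚ.* (x i ℚ.- x j) ℚ.+ (0ℚ ℚ.- (1ℚ ℚ.- s))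
      shift = cong (s ℚ.* (x i ℚ.- x j) ℚ.+_) (sym (ℚₚ.+-identityˡ _))

    above-side : ∀ k l → HP G k l → Above x k l → (k ≡ i × l ≡ j) ⊎ Above y k l
    above-side k l kl above = decide (lifted? k) (lifted? l)
      where
      decide : Dec (Lifted k) → Dec (Lifted l) → (k ≡ i × l ≡ j) ⊎ Above y k l
      decide (no ¬Lk) (yes Ll) = inj₁ (only-ij-dropped k l (jump-true x k l kl above) ¬Lk Ll)
      decide (yes Lk) _        = inj₂ (jump-kept k l (jump-true x k l kl above) (λ (¬Lk , _) → ¬Lk Lk))
      decide (no _)   (no ¬Ll) = inj₂ (jump-kept k l (jump-true x k l kl above) (λ (_ , Ll) → ¬Ll Ll))

    y-generic : Generic G y
    y-generic k l kl on with side x x-generic k l kl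
    ... | inj₂ below = ℚₚ.<-irrefl on (below-kept k l below)
    ... | inj₁ above with above-side k l kl above
    ...   | inj₁ (refl , refl) = ℚₚ.<-irrefl on below-ij
    ...   | inj₂ above-y       = ℚₚ.<-irrefl (sym on) above-y

    y-crossing : Crossing y x i j
    y-crossing = crossing ij below-ij above-ij unchanged
      where
      unchanged : ∀ k l → HP G k l → ¬ (k ≡ i × l ≡ j) → (Below y k l ⇔ Below x k l)
      unchanged k l kl not-ij = mk⇔ to (below-kept k l)
        where
        to : Below y k l → Below x k l
        to below-y with side x x-generic k l kl
        ... | inj₂ below = below
        ... | inj₁ above with above-side k l kl above
        ...   | inj₁ is-ij   = ⊥-elim (not-ij is-ij)
        ...   | inj₂ above-y = ⊥-elim (above⇒¬below y k l above-y below-y)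

  descend : ∀ x → Generic G x → 1 ℕ.≤ height x → ∃[ y ] ∃[ i ] ∃[ j ] (Generic G y × Crossing y x i j)
  descend x x-generic h≥1 with sumℕ-pos (jumps x) h≥1
  ... | i₀ , i₀-jumps with count-pos (jump x i₀) i₀-jumps
  ... | j₀ , jmp with argmin₂ ℚₚ.≤-totalPreorder (jump x) (λ a b → x a ℚ.- x b) (i₀ , j₀ , jmp)
  ... | i , j , ij-jump , shortest = S.y , i , j , S.y-generic , S.y-crossing
    where
    module S = Step x x-generic i j ij-jump shortest
                    (contraction-factor (x i ℚ.- x j) (proj₂ (jump-sound x i j ij-jump)))

-- The closed form is the Pak–Stanley labeling

module PakStanley {n} (G : SimpleGraph n) where
  open Arrangement G
  open Descent G using (descend)

  height≤⇒reach : ∀ k x → Generic G x → height x ℕ.≤ k → Reach G k x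
  height≤⇒reach zero    x x-generic h≤0 = height≡0⇒central x x-generic (ℕₚ.n≤0⇒n≡0 h≤0)
  height≤⇒reach (suc k) x x-generic h≤k+1 with height x ℕ.≤? k
  ... | yes h≤k = inj₁ (height≤⇒reach k x x-generic h≤k)
  ... | no  h≰k = down (descend x x-generic (ℕₚ.≤-trans (s≤s z≤n) (ℕₚ.≰⇒> h≰k)))
    where
    down : ∃[ y ] ∃[ i ] ∃[ j ] (Generic G y × Crossing y x i j) → Reach G (suc k) x
    down (y , i , j , y-generic , cross) =
      inj₂ (y , y-generic , height≤⇒reach k y y-generic hy≤k , crossing⇒border cross)
      where
      hy≤k : height y ℕ.≤ k
      hy≤k = ℕ.s≤s⁻¹ (subst (ℕ._≤ suc k) (Crossed.height-crossed cross x-generic y-generic) h≤k+1)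

  height⇒atDist : ∀ k x → Generic G x → height x ≡ k → AtDist G k x
  height⇒atDist zero    x x-generic h≡0 = height≤⇒reach zero x x-generic (ℕₚ.≤-reflexive h≡0)
  height⇒atDist (suc k) x x-generic h≡k+1 =
    height≤⇒reach (suc k) x x-generic (ℕₚ.≤-reflexive h≡k+1) ,
    λ reach → ℕₚ.<-irrefl refl (subst (ℕ._≤ k) h≡k+1 (reach⇒height≤ k x x-generic reach))

  atDist⇒height : ∀ k x → Generic G x → AtDist G (suc k) x → height x ≡ suc k
  atDist⇒height k x x-generic (reach , ¬reach) with height x ℕ.≤? k
  ... | yes h≤k = ⊥-elim (¬reach (height≤⇒reach k x x-generic h≤k))
  ... | no  h≰k = ℕₚ.≤-antisym (reach⇒height≤ (suc k) x x-generic reach) (ℕₚ.≰⇒> h≰k)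

  above⇒below-reverse : ∀ (x : Pt n) i j → Above x i j → Below x j i
  above⇒below-reverse x i j above = begin-strict
    x j ℚ.- x i        ≡⟨ solve 2 (λ a b → b :- a := :- (a :- b)) refl (x i) (x j) ⟩
    ℚ.- (x i ℚ.- x j)  <⟨ ℚₚ.neg-antimono-< above ⟩
    ℚ.- 1ℚ             <⟨ ℚₚ.<-trans (ℚₚ.negative⁻¹ (ℚ.- 1ℚ)) (ℚₚ.positive⁻¹ 1ℚ) ⟩
    1ℚ                 ∎
    where
    open ℚₚ.≤-Reasoning
    open ℚ-Solver.+-*-Solver

  canonicalLabel-isPakStanley : IsPakStanley G canonicalLabel
  canonicalLabel-isPakStanley = constant , central , layered
    where
    constant : ∀ x y → Generic G x → Generic G y → SameRegion G x y → canonicalLabel x ≡ canonicalLabel y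
    constant x y x-generic y-generic same = Vecₚ.tabulate-cong at
      where
      at : ∀ u → canonicalLabelAt x u ≡ canonicalLabelAt y u
      at zero    = refl
      at (suc a) = cong (λ m → sinkOffset a ℤ.+ + m)
        (count-cong (λ l → jump-cong x y x-generic y-generic a l
          (λ al → ⇔.sym (same a l al))))

    central : ∀ x → Generic G x → Central G x → canonicalLabel x ≡ baseLabel G
    central x _ = canonicalLabel-central x

    layered : ∀ k x → Generic G x → AtDist G (suc k) x →
      ∃[ y ] (Generic G y × AtDist G k y × Border G y x ×
        ∃[ i ] ∃[ j ] (HP G j i × Below y i j × Below y j i × Above x j i ×
                       canonicalLabel x ≡ addVertex (canonicalLabel y) (suc j)))
    layered k x x-generic dist@(inj₁ reach , ¬reach) = ⊥-elim (¬reach reach)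
    layered k x x-generic dist@(inj₂ (y , y-generic , reach , border) , _) with border⇒crossing x y border
    ... | inj₁ (i , j , cross@(crossing ij below above others)) =
      y , y-generic , height⇒atDist k y y-generic hy≡k , border ,
      j , i , ij , above⇒below-reverse-y , below , above , Crossed.canonicalLabel-crossed cross x-generic y-generic
      where
      hy≡k : height y ≡ k
      hy≡k = ℕₚ.suc-injective (trans (sym (Crossed.height-crossed cross x-generic y-generic))
                                     (atDist⇒height k x x-generic dist))
      above⇒below-reverse-y : Below y j i
      above⇒below-reverse-y = Equivalence.from (others j i (edge-sym i j ij) (λ (j≡i , _) → edge-irrefl i j ij (sym j≡i)))
                                               (above⇒below-reverse x i j above)
    ... | inj₂ (i , j , cross) = ⊥-elim (ℕₚ.<-irrefl refl (ℕₚ.≤-trans (ℕₚ.n≤1+n _) (subst (ℕ._≤ k) hy reach-bound)))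
      where
      hy : height y ≡ suc (suc k)
      hy = trans (Crossed.height-crossed cross y-generic x-generic) (cong suc (atDist⇒height k x x-generic dist))
      reach-bound : height y ℕ.≤ k
      reach-bound = reach⇒height≤ k y y-generic reach

  isPakStanley-unique : ∀ lab → IsPakStanley G lab → ∀ x → Generic G x → lab x ≡ canonicalLabel x
  isPakStanley-unique lab (_ , central , layered) x x-generic =
    by-distance (height x) x x-generic (height⇒atDist (height x) x x-generic refl)
    where
    by-distance : ∀ k x → Generic G x → AtDist G k x → lab x ≡ canonicalLabel x
    by-distance zero x x-generic central-x =
      trans (central x x-generic central-x) (sym (canonicalLabel-central x central-x))
    by-distance (suc k) x x-generic dist
      with layered k x x-generic dist
    ... | y , y-generic , y-dist , (i₀ , j₀ , _ , _ , others) , i , j , ji , below-ij , below-ji , above-ji , lab-x =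
      begin
        lab x                                        ≡⟨ lab-x ⟩
        addVertex (lab y) (suc j)                    ≡⟨ cong (λ v → addVertex v (suc j)) (by-distance k y y-generic y-dist) ⟩
        addVertex (canonicalLabel y) (suc j)         ≡⟨ Crossed.canonicalLabel-crossed cross x-generic y-generic ⟨
        canonicalLabel x                             ∎
      where
      open ≡-Reasoning
      -- The bordering hyperplane must be the one x_j − x_i = 1 that y and x lie on either side of.
      cross : Crossing y x j i
      cross with j Fin.≟ i₀ | i Fin.≟ j₀
      ... | yes refl | yes refl = crossing ji below-ji above-ji others
      ... | no j≢i₀ | _        = ⊥-elim (above⇒¬below x j i above-ji (Equivalence.to (others j i ji (j≢i₀ ∘ proj₁)) below-ji))
      ... | yes _   | no i≢j₀  = ⊥-elim (above⇒¬below x j i above-ji (Equivalence.to (others j i ji (i≢j₀ ∘ proj₂)) below-ji))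

-- Admissible regions have superstable labels

module AdmissibleRegions {n} (G : SimpleGraph n) where
  open Arrangement G
  open Cone G using (InS̃₀⇔superstable)
  module LG = Laplacian (adj G) (loopless G)

  sinkOffset≡ : ∀ a → sinkOffset a ≡ b2z (adj G (suc a) zero) ℤ.- 1ℤ
  sinkOffset≡ a rewrite symmetric G zero (suc a) with adj G (suc a) zero
  ... | true  = refl
  ... | false = refl

  configuration : Pt n → Vec ℤ n
  configuration x = tabulate (canonicalLabelAt x ∘ suc)

  jumps≤outside : ∀ x (Y : Subset n) a → (∀ b → lookup Y b ≡ true → x a ℚ.≤ x b) →
                  jumps x a ℕ.≤ count (λ b → edge a b ∧ not (lookup Y b))
  jumps≤outside x Y a lowest = count-mono outside
    where
    outside : ∀ b → jump x a b ≡ true → edge a b ∧ not (lookup Y b) ≡ true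
    outside b jmp with lookup Y b in b∈?Y
    ... | false = ∧-true (proj₁ (jump-sound x a b jmp)) refl
    ... | true  = ⊥-elim (above⇒¬below x a b (proj₂ (jump-sound x a b jmp))
                                        (≤⇒below x a b (lowest b b∈?Y)))

  -- A lowest vertex of Y has no jump into Y, so it cannot afford to fire with Y.
  configuration-superstable : ∀ x → Generic G x → Admissible G x → Superstable (adj G) (configuration x)
  configuration-superstable x x-generic admissible = nonneg , stable
    where
    nonneg : ∀ a → 0ℤ ℤ.≤ lookup (configuration x) a
    nonneg a rewrite Vecₚ.lookup∘tabulate (canonicalLabelAt x ∘ suc) a with adj G zero (suc a) in a~v₀
    ... | true  = ℤ.+≤+ z≤n
    ... | false with admissible a
    ...   | inj₁ a~v₀′ = ⊥-elim (true≢false (trans (sym a~v₀′) (trans (symmetric G (suc a) zero) a~v₀)))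
    ...   | inj₂ (b , ab , above) with jumps x a | count-≥1 (jump x a) b (jump-true x a b ab above)
    ...     | suc _ | _ = ℤ.+≤+ z≤n

    stable : ∀ Y → Nonempty Y → ¬ (∀ a → 0ℤ ℤ.≤ lookup (configuration x) a ℤ.- reducedLapInd (adj G) Y a)
    stable Y (a₀ , a₀∈Y) legal with argmin ℚₚ.≤-totalPreorder (lookup Y) x (a₀ , Vecₚ.[]=⇒lookup a₀∈Y)
    ... | a , a∈Y , lowest = -1≱0 (ℤₚ.≤-trans (subst (0ℤ ℤ.≤_) balance (legal a))
                                               (ℤₚ.+-monoˡ-≤ -1ℤ (ℤₚ.i≤j⇒i-j≤0 (ℤ.+≤+ (jumps≤outside x Y a lowest)))))
      where
      up out : ℤ
      up  = + jumps x a
      out = + count (λ b → edge a b ∧ not (lookup Y b))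
      -1≱0 : ¬ (0ℤ ℤ.≤ -1ℤ)
      -1≱0 ()
      balance : lookup (configuration x) a ℤ.- reducedLapInd (adj G) Y a ≡ (up ℤ.- out) ℤ.+ -1ℤ
      balance rewrite Vecₚ.lookup∘tabulate (canonicalLabelAt x ∘ suc) a
                    | LG.reducedLapInd-inside Y a a∈Y | sinkOffset≡ a =
        solve 3 (λ B J O → (B :- con 1ℤ) :+ J :- (B :+ O) := (J :- O) :+ con -1ℤ) refl (b2z (adj G (suc a) zero)) up out
        where open ℤ-Solver.+-*-Solver

  admissible-label∈S̃₀ : ∀ x → Generic G x → Admissible G x → InS̃₀ G (canonicalLabel x)
  admissible-label∈S̃₀ x x-generic admissible =
    Equivalence.from (InS̃₀⇔superstable (canonicalLabel x))
      (configuration x , configuration-superstable x x-generic admissible , refl)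

-- Dhar's burning algorithm

farBelow justBelow : ∀ {n} → SimpleGraph n → (Fin n → ℕ) → Fin n → ℕ
farBelow  G level a = count (λ b → adj G (suc a) (suc b) ∧ does (suc (suc (level b)) ℕ.≤? level a))
justBelow G level a = count (λ b → adj G (suc a) (suc b) ∧ does (suc (level b) ℕ.≟ level a))

module Burning {n} (G : SimpleGraph n) (c : Vec ℤ n) (c-superstable : Superstable (adj G) c) where
  open Arrangement G using (edge)
  module LG = Laplacian (adj G) (loopless G)

  chips : Fin n → ℕ
  chips a = ℤ.∣ lookup c a ∣

  +chips : ∀ a → + chips a ≡ lookup c a
  +chips a = ℤₚ.0≤i⇒+∣i∣≡i (proj₁ c-superstable a)

  -- Fire spreads from the sink; a vertex catches fire once its burning neighbours,
  -- the sink included, outnumber its chips.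
  threshold : Fin n → ℕ
  threshold a = if adj G (suc a) zero then chips a else suc (chips a)

  burntNeighbours : (Fin n → Bool) → Fin n → ℕ
  burntNeighbours B a = count (λ b → edge a b ∧ B b)

  -- Superstability applied to the set Y of unburnt vertices.
  burn-step : ∀ B → ∃[ a ] B a ≡ false → ∃[ a ] (B a ≡ false × threshold a ℕ.≤ burntNeighbours B a)
  burn-step B (a₀ , a₀-unburnt)
    with Finₚ.any? (λ a → (B a Boolₚ.≟ false) ×-dec (threshold a ℕ.≤? burntNeighbours B a))
  ... | yes found = found
  ... | no none = ⊥-elim (proj₂ c-superstable Y (a₀ , Vecₚ.lookup⇒[]= a₀ Y (trans (Y≡ a₀) (cong not a₀-unburnt))) legal)
    where
    Y : Subset n
    Y = tabulate (not ∘ B)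
    Y≡ : ∀ b → lookup Y b ≡ not (B b)
    Y≡ = Vecₚ.lookup∘tabulate (not ∘ B)
    legal : ∀ a → 0ℤ ℤ.≤ lookup c a ℤ.- reducedLapInd (adj G) Y a
    legal a with B a in Ba
    ... | true = ℤₚ.i≤j⇒0≤j-i (ℤₚ.≤-trans (LG.reducedLapInd-outside Y a (trans (Y≡ a) (cong not Ba)))
                                          (proj₁ c-superstable a))
    ... | false = subst (0ℤ ℤ.≤_) (cong₂ ℤ._-_ (+chips a) (sym laplacian≡))
                        (ℤₚ.i≤j⇒0≤j-i (affordable (adj G (suc a) zero) (ℕₚ.≰⇒> (λ le → none (a , Ba , le)))))
      where
      burnt≡ : count (λ b → edge a b ∧ not (lookup Y b)) ≡ burntNeighbours B a
      burnt≡ = count-cong (λ b → cong (edge a b ∧_) (trans (cong not (Y≡ b)) (Boolₚ.not-involutive (B b))))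
      laplacian≡ : reducedLapInd (adj G) Y a ≡ b2z (adj G (suc a) zero) ℤ.+ + burntNeighbours B a
      laplacian≡ = trans (LG.reducedLapInd-inside Y a (trans (Y≡ a) (cong not Ba)))
                         (cong (λ m → b2z (adj G (suc a) zero) ℤ.+ + m) burnt≡)
      affordable : ∀ e → burntNeighbours B a ℕ.< (if e then chips a else suc (chips a)) →
                   b2z e ℤ.+ + burntNeighbours B a ℤ.≤ + chips a
      affordable true  lt = ℤ.+≤+ lt
      affordable false lt = ℤ.+≤+ (ℕ.s≤s⁻¹ lt)

  burnt : ℕ → Fin n → Bool
  burnt zero    a = false
  burnt (suc k) a = burnt k a ∨ does (threshold a ℕ.≤? burntNeighbours (burnt k) a)

  burnt-suc : ∀ k a → burnt k a ≡ true → burnt (suc k) a ≡ true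
  burnt-suc k a burning rewrite burning = refl

  burnt-mono : ∀ k m a → k ℕ.≤ m → burnt k a ≡ true → burnt m a ≡ true
  burnt-mono k m a k≤m burning = subst (λ l → burnt l a ≡ true) (ℕₚ.m∸n+n≡m k≤m) (later (m ℕ.∸ k))
    where
    later : ∀ d → burnt (d ℕ.+ k) a ≡ true
    later zero    = burning
    later (suc d) = burnt-suc (d ℕ.+ k) a (later d)

  burnt-grows : ∀ k → (∀ a → burnt k a ≡ true) ⊎ k ℕ.≤ count (burnt k)
  burnt-grows zero = inj₂ z≤n
  burnt-grows (suc k) with burnt-grows k
  ... | inj₁ all = inj₁ (λ a → burnt-suc k a (all a))
  ... | inj₂ k≤count with Finₚ.all? (λ a → burnt k a Boolₚ.≟ true)
  ...   | yes all = inj₁ (λ a → burnt-suc k a (all a))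
  ...   | no ¬all with Finₚ.¬∀⟶∃¬ n (λ a → burnt k a ≡ true) (λ a → burnt k a Boolₚ.≟ true) ¬all
  ...     | a₀ , a₀-unburnt with burn-step (burnt k) (a₀ , Boolₚ.¬-not a₀-unburnt)
  ...       | a , a-unburnt , catches =
    inj₂ (ℕₚ.≤-trans (s≤s k≤count) (count-mono-< (burnt-suc k) a a-unburnt a-burnt))
    where
    a-burnt : burnt (suc k) a ≡ true
    a-burnt rewrite a-unburnt = dec-true (threshold a ℕ.≤? burntNeighbours (burnt k) a) catches

  burnt-all : ∀ a → burnt n a ≡ true
  burnt-all a with burnt-grows n
  ... | inj₁ all = all a
  ... | inj₂ n≤count with burnt n a in unburnt
  ...   | true  = refl
  ...   | false = ⊥-elim (ℕₚ.<-irrefl refl (ℕₚ.<-≤-trans (count-< (burnt n) a unburnt) n≤count))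

  level : Fin n → ℕ
  level a = least (λ k → burnt k a) n

  level≤n : ∀ a → level a ℕ.≤ n
  level≤n a = least-≤ (λ k → burnt k a) n

  burnt-at-level : ∀ a → burnt (level a) a ≡ true
  burnt-at-level a = least-true (λ k → burnt k a) n (burnt-all a)

  unburnt-below-level : ∀ k a → k ℕ.< level a → burnt k a ≡ false
  unburnt-below-level k a = least-minimal (λ k → burnt k a) n k

  burnt≡ : ∀ k a → burnt k a ≡ does (level a ℕ.≤? k)
  burnt≡ k a = ≡does (level a ℕ.≤? k) (λ level≤k → burnt-mono (level a) k a level≤k (burnt-at-level a))
                                      (λ level≰k → unburnt-below-level k a (ℕₚ.≰⇒> level≰k))

  level≥1 : ∀ a → 1 ℕ.≤ level a
  level≥1 a with level a in eq
  ... | suc _ = s≤s z≤n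
  ... | zero  = ⊥-elim (true≢false (trans (sym (subst (λ l → burnt l a ≡ true) eq (burnt-at-level a))) refl))

  burntNeighbours-level : ∀ k a → burntNeighbours (burnt k) a ≡ count (λ b → edge a b ∧ does (level b ℕ.≤? k))
  burntNeighbours-level k a = count-cong (λ b → cong (edge a b ∧_) (burnt≡ k b))

  -- a caught fire in round level a, and not in the round before.
  threshold≤far+just : ∀ a → threshold a ℕ.≤ farBelow G level a ℕ.+ justBelow G level a
  threshold≤far+just a = by-level (level a) refl
    where
    by-level : ∀ m → level a ≡ m → threshold a ℕ.≤ farBelow G level a ℕ.+ justBelow G level a
    by-level zero    eq = ⊥-elim (ℕₚ.<-irrefl (sym eq) (level≥1 a))
    by-level (suc L) eq = subst (threshold a ℕ.≤_) (trans (burntNeighbours-level L a) split)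
                                (dec-true⁻¹ (threshold a ℕ.≤? burntNeighbours (burnt L) a) catches)
      where
      catches : does (threshold a ℕ.≤? burntNeighbours (burnt L) a) ≡ true
      catches = subst (λ u → u ∨ does (threshold a ℕ.≤? burntNeighbours (burnt L) a) ≡ true)
                      (unburnt-below-level L a (subst (L ℕ.<_) (sym eq) ℕₚ.≤-refl))
                      (subst (λ l → burnt l a ≡ true) eq (burnt-at-level a))
      split : count (λ b → edge a b ∧ does (level b ℕ.≤? L)) ≡ farBelow G level a ℕ.+ justBelow G level a
      split = count-∨ _ _ _ pointwise disjoint
        where
        pointwise : ∀ b → (edge a b ∧ does (level b ℕ.≤? L)) ≡
          (edge a b ∧ does (suc (suc (level b)) ℕ.≤? level a)) ∨ (edge a b ∧ does (suc (level b) ℕ.≟ level a))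
        pointwise b = trans (cong (edge a b ∧_) (does-⊎ (level b ℕ.≤? L) (suc (suc (level b)) ℕ.≤? level a)
                                                       (suc (level b) ℕ.≟ level a) to fromFar fromJust))
                            (Boolₚ.∧-distribˡ-∨ (edge a b) _ _)
          where
          to : level b ℕ.≤ L → suc (suc (level b)) ℕ.≤ level a ⊎ suc (level b) ≡ level a
          to le with ℕₚ.m≤n⇒m<n∨m≡n le
          ... | inj₁ lt = inj₁ (subst (suc (suc (level b)) ℕ.≤_) (sym eq) (s≤s lt))
          ... | inj₂ refl = inj₂ (sym eq)
          fromFar : suc (suc (level b)) ℕ.≤ level a → level b ℕ.≤ L
          fromFar le = ℕₚ.<⇒≤ (ℕ.s≤s⁻¹ (subst (suc (suc (level b)) ℕ.≤_) eq le))
          fromJust : suc (level b) ≡ level a → level b ℕ.≤ L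
          fromJust e = ℕₚ.≤-reflexive (ℕₚ.suc-injective (trans e eq))
        disjoint : ∀ b → (edge a b ∧ does (suc (suc (level b)) ℕ.≤? level a)) ≡ true →
                   (edge a b ∧ does (suc (level b) ℕ.≟ level a)) ≡ false
        disjoint b far with ∧-true⁻¹ {edge a b} far
        ... | _ , far′ = trans (cong (edge a b ∧_) (dec-false (suc (level b) ℕ.≟ level a) λ e →
                                 ℕₚ.1+n≰n (subst (suc (suc (level b)) ℕ.≤_) (sym e) (dec-true⁻¹ (_ ℕ.≤? _) far′))))
                               (Boolₚ.∧-zeroʳ (edge a b))

  far≤threshold : ∀ a → farBelow G level a ℕ.≤ threshold a
  far≤threshold a = by-level (level a) refl
    where
    by-level : ∀ m → level a ≡ m → farBelow G level a ℕ.≤ threshold a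
    by-level zero eq = ⊥-elim (ℕₚ.<-irrefl (sym eq) (level≥1 a))
    by-level (suc zero) eq = ℕₚ.≤-trans (ℕₚ.≤-reflexive (count-zero _ none)) z≤n
      where
      none : ∀ b → (edge a b ∧ does (suc (suc (level b)) ℕ.≤? level a)) ≡ false
      none b = trans (cong (edge a b ∧_) (dec-false (_ ℕ.≤? level a) (λ le → 2+≰1 (subst (suc (suc (level b)) ℕ.≤_) eq le))))
                     (Boolₚ.∧-zeroʳ (edge a b))
        where
        2+≰1 : ∀ {m} → ¬ (suc (suc m) ℕ.≤ 1)
        2+≰1 (s≤s ())
    by-level (suc (suc L)) eq = ℕₚ.<⇒≤ (subst (ℕ._< threshold a) far≡ (ℕₚ.≰⇒> (dec-false⁻¹ (threshold a ℕ.≤? burntNeighbours (burnt L) a) unburnt)))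
      where
      unburnt : does (threshold a ℕ.≤? burntNeighbours (burnt L) a) ≡ false
      unburnt = proj₂ (∨-false⁻¹ (unburnt-below-level (suc L) a (subst (suc L ℕ.<_) (sym eq) ℕₚ.≤-refl)))
      far≡ : burntNeighbours (burnt L) a ≡ farBelow G level a
      far≡ = trans (burntNeighbours-level L a) (count-cong (λ b → cong (edge a b ∧_)
               (does-⇔ (mk⇔ (λ le → subst (suc (suc (level b)) ℕ.≤_) (sym eq) (s≤s (s≤s le)))
                            (λ le → ℕ.s≤s⁻¹ (ℕ.s≤s⁻¹ (subst (suc (suc (level b)) ℕ.≤_) eq le))))
                       (level b ℕ.≤? L) (suc (suc (level b)) ℕ.≤? level a))))

-- Integer positions realising prescribed jump counts

-- Vertex a must end up more than D above exactly t a neighbours.  Placing it at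
-- level a · D plus an offset below D puts it above all neighbours two or more levels
-- down and none on its own level or higher, so the remaining t a − farBelow a jumps
-- are chosen among the neighbours one level down by ranking their offsets.  Offsets
-- are written in base n + 1 with the vertex index as last digit, so they never tie.
module Positions {n} (G : SimpleGraph n) (t level : Fin n → ℕ)
  (level≥1 : ∀ a → 1 ℕ.≤ level a) (level≤n : ∀ a → level a ℕ.≤ n)
  (far≤t : ∀ a → farBelow G level a ℕ.≤ t a)
  (t≤far+just : ∀ a → t a ℕ.≤ farBelow G level a ℕ.+ justBelow G level a) where

  open Arrangement G using (edge)
  open ℕ-Solver.+-*-Solver

  base : ℕ
  base = suc n

  base^-positive : ∀ L → 1 ℕ.≤ base ℕ.^ L
  base^-positive L = ℕₚ.m^n>0 base L

  digit : Fin n → ℕ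
  digit a = suc (Fin.toℕ a)

  digit<base : ∀ a → digit a ℕ.< base
  digit<base a = s≤s (Finₚ.toℕ<n a)

  needed : Fin n → ℕ
  needed a = t a ℕ.∸ farBelow G level a

  rankBelow : (Fin n → ℕ) → ℕ → Fin n → ℕ → ℕ
  rankBelow key L a K = count (λ b → edge a b ∧ (does (level b ℕ.≟ L) ∧ does (key b ℕ.≤? K)))

  key : ℕ → Fin n → ℕ
  cut : ℕ → Fin n → ℕ

  key zero    a = digit a
  key (suc L) a = base ℕ.* cut L a ℕ.+ digit a

  cut L a = least (λ K → does (needed a ℕ.≤? rankBelow (key L) L a K)) (base ℕ.^ L ℕ.∸ 1)

  key≥1 : ∀ L a → 1 ℕ.≤ key L a
  key≥1 zero    a = s≤s z≤n
  key≥1 (suc L) a = ℕₚ.≤-trans (s≤s z≤n) (ℕₚ.m≤n+m (digit a) (base ℕ.* cut L a))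

  key%base : ∀ L a → key L a DivMod.% base ≡ digit a
  key%base zero    a = DivMod.m<n⇒m%n≡m (digit<base a)
  key%base (suc L) a = begin
    (base ℕ.* cut L a ℕ.+ digit a) DivMod.% base ≡⟨ cong (DivMod._% base) (ℕₚ.+-comm (base ℕ.* cut L a) (digit a)) ⟩
    (digit a ℕ.+ base ℕ.* cut L a) DivMod.% base ≡⟨ cong (λ m → (digit a ℕ.+ m) DivMod.% base) (ℕₚ.*-comm base (cut L a)) ⟩
    (digit a ℕ.+ cut L a ℕ.* base) DivMod.% base ≡⟨ DivMod.[m+kn]%n≡m%n (digit a) (cut L a) base ⟩
    digit a DivMod.% base                        ≡⟨ DivMod.m<n⇒m%n≡m (digit<base a) ⟩
    digit a                                      ∎
    where open ≡-Reasoning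

  key-injective : ∀ L a b → key L a ≡ key L b → a ≡ b
  key-injective L a b eq = Finₚ.toℕ-injective (ℕₚ.suc-injective
    (trans (sym (key%base L a)) (trans (cong (DivMod._% base) eq) (key%base L b))))

  key<base^ : ∀ L a → key (suc L) a ℕ.< base ℕ.^ suc L
  key<base^ L a = ℕₚ.<-≤-trans (ℕₚ.+-monoʳ-< (base ℕ.* cut L a) (digit<base a)) (begin
    base ℕ.* cut L a ℕ.+ base ≡⟨ ℕₚ.+-comm (base ℕ.* cut L a) base ⟩
    base ℕ.+ base ℕ.* cut L a ≡⟨ ℕₚ.*-suc base (cut L a) ⟨
    base ℕ.* suc (cut L a)    ≤⟨ ℕₚ.*-monoʳ-≤ base cut<base^ ⟩
    base ℕ.^ suc L            ∎)
    where
    open ℕₚ.≤-Reasoning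
    cut<base^ : suc (cut L a) ℕ.≤ base ℕ.^ L
    cut<base^ = subst (suc (cut L a) ℕ.≤_) (ℕₚ.suc-pred (base ℕ.^ L) {{ℕ.>-nonZero (base^-positive L)}})
                      (s≤s (least-≤ _ (base ℕ.^ L ℕ.∸ 1)))

  rank-zero : ∀ L a → rankBelow (key L) L a 0 ≡ 0
  rank-zero L a = count-zero _ none
    where
    none : ∀ b → (edge a b ∧ (does (level b ℕ.≟ L) ∧ does (key L b ℕ.≤? 0))) ≡ false
    none b rewrite dec-false (key L b ℕ.≤? 0) (λ le → ℕₚ.<-irrefl refl (ℕₚ.<-≤-trans (key≥1 L b) le))
                 | Boolₚ.∧-zeroʳ (does (level b ℕ.≟ L)) = Boolₚ.∧-zeroʳ (edge a b)

  -- Keys on a level are distinct, so raising the bound by one adds at most one neighbour.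
  rank-suc : ∀ L a K → rankBelow (key L) L a (suc K) ℕ.≤ suc (rankBelow (key L) L a K)
  rank-suc L a K = ℕₚ.≤-trans (count-∨-≤ _ _ (λ b → does (key L b ℕ.≟ suc K)) split)
    (subst (rankBelow (key L) L a K ℕ.+ count (λ b → does (key L b ℕ.≟ suc K)) ℕ.≤_)
           (ℕₚ.+-comm (rankBelow (key L) L a K) 1)
           (ℕₚ.+-monoʳ-≤ (rankBelow (key L) L a K) (count-≤1 _ unique)))
    where
    split : ∀ b → (edge a b ∧ (does (level b ℕ.≟ L) ∧ does (key L b ℕ.≤? suc K))) ≡ true →
            (edge a b ∧ (does (level b ℕ.≟ L) ∧ does (key L b ℕ.≤? K))) ≡ true ⊎ does (key L b ℕ.≟ suc K) ≡ true
    split b in-rank with ∧-true⁻¹ {edge a b} in-rank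
    ... | ab , rest with ∧-true⁻¹ {does (level b ℕ.≟ L)} rest
    ...   | on-L , le with ℕₚ.m≤n⇒m<n∨m≡n (dec-true⁻¹ (key L b ℕ.≤? suc K) le)
    ...     | inj₁ lt = inj₁ (∧-true ab (∧-true on-L (dec-true (key L b ℕ.≤? K) (ℕ.s≤s⁻¹ lt))))
    ...     | inj₂ eq = inj₂ (dec-true (key L b ℕ.≟ suc K) eq)
    unique : ∀ b b′ → does (key L b ℕ.≟ suc K) ≡ true → does (key L b′ ℕ.≟ suc K) ≡ true → b ≡ b′
    unique b b′ p q = key-injective L b b′ (trans (dec-true⁻¹ (key L b ℕ.≟ suc K) p) (sym (dec-true⁻¹ (key L b′ ℕ.≟ suc K) q)))

  rank-top : ∀ L a → rankBelow (key L) L a (base ℕ.^ L ℕ.∸ 1) ≡ count (λ b → edge a b ∧ does (level b ℕ.≟ L))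
  rank-top L a = count-cong (λ b → cong (edge a b ∧_) (bounded b (level b ℕ.≟ L)))
    where
    bounded : ∀ b (on-L? : Dec (level b ≡ L)) → (does on-L? ∧ does (key L b ℕ.≤? (base ℕ.^ L ℕ.∸ 1))) ≡ does on-L?
    bounded b (no _)   = refl
    bounded b (yes on-L) = dec-true (key L b ℕ.≤? (base ℕ.^ L ℕ.∸ 1)) (key-bound L on-L)
      where
      key-bound : ∀ L → level b ≡ L → key L b ℕ.≤ base ℕ.^ L ℕ.∸ 1
      key-bound zero    eq = ⊥-elim (ℕₚ.<-irrefl (sym eq) (level≥1 b))
      key-bound (suc L) eq = ℕₚ.∸-monoˡ-≤ 1 (key<base^ L b)

  needed≤rank-top : ∀ L a → level a ≡ suc L → needed a ℕ.≤ rankBelow (key L) L a (base ℕ.^ L ℕ.∸ 1)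
  needed≤rank-top L a eq = subst (needed a ℕ.≤_) (sym (trans (rank-top L a) (count-cong (λ b → cong (edge a b ∧_)
      (does-⇔ (mk⇔ (λ e → trans (cong suc e) (sym eq)) (λ e → ℕₚ.suc-injective (trans e eq)))
              (level b ℕ.≟ L) (suc (level b) ℕ.≟ level a))))))
    (ℕₚ.m≤n+o⇒m∸n≤o (t a) (farBelow G level a) (t≤far+just a))

  -- The rank grows in steps of at most one from 0, so it hits needed a exactly.
  rank-cut : ∀ L a → level a ≡ suc L → rankBelow (key L) L a (cut L a) ≡ needed a
  rank-cut L a eq = hit (cut L a) refl
    where
    enough? : ℕ → Bool
    enough? K = does (needed a ℕ.≤? rankBelow (key L) L a K)
    enough : needed a ℕ.≤ rankBelow (key L) L a (cut L a)
    enough = dec-true⁻¹ (needed a ℕ.≤? _)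
               (least-true enough? (base ℕ.^ L ℕ.∸ 1) (dec-true (needed a ℕ.≤? _) (needed≤rank-top L a eq)))
    hit : ∀ K → cut L a ≡ K → rankBelow (key L) L a (cut L a) ≡ needed a
    hit zero eq′ = ℕₚ.≤-antisym (subst (ℕ._≤ needed a) (sym (trans (cong (rankBelow (key L) L a) eq′) (rank-zero L a))) z≤n) enough
    hit (suc K) eq′ = ℕₚ.≤-antisym (ℕₚ.≤-trans (subst (λ k → rankBelow (key L) L a k ℕ.≤ suc (rankBelow (key L) L a K)) (sym eq′) (rank-suc L a K)) short) enough
      where
      short : rankBelow (key L) L a K ℕ.< needed a
      short = ℕₚ.≰⇒> (dec-false⁻¹ (needed a ℕ.≤? _)
                (least-minimal enough? (base ℕ.^ L ℕ.∸ 1) K (subst (K ℕ.<_) (sym eq′) ℕₚ.≤-refl)))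

  scale : ℕ
  scale = base ℕ.^ n

  offset : Fin n → ℕ
  offset a = key (level a) a ℕ.* base ℕ.^ (n ℕ.∸ level a)

  position : Fin n → ℕ
  position a = level a ℕ.* scale ℕ.+ offset a

  offset<scale : ∀ a → offset a ℕ.< scale
  offset<scale a = by-level (level a) refl
    where
    by-level : ∀ m → level a ≡ m → offset a ℕ.< scale
    by-level zero    eq = ⊥-elim (ℕₚ.<-irrefl (sym eq) (level≥1 a))
    by-level (suc L) eq = subst₂ (λ l s → key l a ℕ.* base ℕ.^ (n ℕ.∸ l) ℕ.< s) (sym eq) base^n
      (ℕₚ.*-monoˡ-< (base ℕ.^ (n ℕ.∸ suc L)) {{ℕ.>-nonZero (base^-positive (n ℕ.∸ suc L))}} (key<base^ L a))
      where
      base^n : base ℕ.^ suc L ℕ.* base ℕ.^ (n ℕ.∸ suc L) ≡ scale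
      base^n = trans (sym (ℕₚ.^-distribˡ-+-* base (suc L) (n ℕ.∸ suc L)))
                     (cong (base ℕ.^_) (ℕₚ.m+[n∸m]≡n (subst (ℕ._≤ n) eq (level≤n a))))

  far-level : ∀ a b → suc (suc (level b)) ℕ.≤ level a → position b ℕ.+ scale ℕ.< position a
  far-level a b le = begin-strict
    level b ℕ.* scale ℕ.+ offset b ℕ.+ scale    <⟨ ℕₚ.+-monoˡ-< scale (ℕₚ.+-monoʳ-< (level b ℕ.* scale) (offset<scale b)) ⟩
    level b ℕ.* scale ℕ.+ scale ℕ.+ scale       ≡⟨ solve 2 (λ l s → l :* s :+ s :+ s := (con 2 :+ l) :* s) refl (level b) scale ⟩
    suc (suc (level b)) ℕ.* scale               ≤⟨ ℕₚ.*-monoˡ-≤ scale le ⟩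
    level a ℕ.* scale                           ≤⟨ ℕₚ.m≤m+n (level a ℕ.* scale) (offset a) ⟩
    position a                                  ∎
    where open ℕₚ.≤-Reasoning

  lower-or-same-level : ∀ a b → level a ℕ.≤ level b → position a ℕ.< position b ℕ.+ scale
  lower-or-same-level a b le = begin-strict
    level a ℕ.* scale ℕ.+ offset a              <⟨ ℕₚ.+-monoʳ-< (level a ℕ.* scale) (offset<scale a) ⟩
    level a ℕ.* scale ℕ.+ scale                 ≤⟨ ℕₚ.+-mono-≤ (ℕₚ.*-monoˡ-≤ scale le) (ℕₚ.m≤n+m scale (offset b)) ⟩
    level b ℕ.* scale ℕ.+ (offset b ℕ.+ scale)  ≡⟨ ℕₚ.+-assoc (level b ℕ.* scale) (offset b) scale ⟨
    position b ℕ.+ scale                        ∎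
    where open ℕₚ.≤-Reasoning

  module NextLevel (a b : Fin n) (a-above-b : level a ≡ suc (level b)) where
    L : ℕ
    L = level b

    P : ℕ
    P = base ℕ.^ (n ℕ.∸ suc L)

    P-positive : 1 ℕ.≤ P
    P-positive = base^-positive (n ℕ.∸ suc L)

    offset-a : offset a ≡ (base ℕ.* cut L a ℕ.+ digit a) ℕ.* P
    offset-a = cong (λ l → key l a ℕ.* base ℕ.^ (n ℕ.∸ l)) a-above-b

    offset-b : offset b ≡ key L b ℕ.* (base ℕ.* P)
    offset-b = cong (λ m → key L b ℕ.* base ℕ.^ m) (n∸L≡1+n∸1+L (subst (ℕ._≤ n) a-above-b (level≤n a)))
      where
      n∸L≡1+n∸1+L : suc L ℕ.≤ n → n ℕ.∸ L ≡ suc (n ℕ.∸ suc L)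
      n∸L≡1+n∸1+L le = ℕₚ.+-∸-assoc 1 le

    position-a : position a ≡ (L ℕ.* scale ℕ.+ scale) ℕ.+ offset a
    position-a = trans (cong (λ l → l ℕ.* scale ℕ.+ offset a) a-above-b)
                       (solve 3 (λ l s o → (con 1 :+ l) :* s :+ o := (l :* s :+ s) :+ o) refl L scale (offset a))

    position-b : position b ℕ.+ scale ≡ (L ℕ.* scale ℕ.+ scale) ℕ.+ offset b
    position-b = solve 3 (λ l s o → l :* s :+ o :+ s := (l :* s :+ s) :+ o) refl L scale (offset b)

    jump-if-ranked : key L b ℕ.≤ cut L a → position b ℕ.+ scale ℕ.< position a
    jump-if-ranked le = subst₂ ℕ._<_ (sym position-b) (sym position-a)
      (ℕₚ.+-monoʳ-< (L ℕ.* scale ℕ.+ scale) (subst₂ ℕ._<_ (sym offset-b) (sym offset-a) (begin-strict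
        key L b ℕ.* (base ℕ.* P)                 ≤⟨ ℕₚ.*-monoˡ-≤ (base ℕ.* P) le ⟩
        cut L a ℕ.* (base ℕ.* P)                 ≡⟨ solve 3 (λ b k p → k :* (b :* p) := b :* k :* p) refl base (cut L a) P ⟩
        base ℕ.* cut L a ℕ.* P                   <⟨ ℕₚ.*-monoˡ-< P {{ℕ.>-nonZero P-positive}} (ℕₚ.m<m+n (base ℕ.* cut L a) (s≤s z≤n)) ⟩
        (base ℕ.* cut L a ℕ.+ digit a) ℕ.* P     ∎)))
      where open ℕₚ.≤-Reasoning

    no-jump-if-unranked : cut L a ℕ.< key L b → position a ℕ.< position b ℕ.+ scale
    no-jump-if-unranked lt = subst₂ ℕ._<_ (sym position-a) (sym position-b)
      (ℕₚ.+-monoʳ-< (L ℕ.* scale ℕ.+ scale) (subst₂ ℕ._<_ (sym offset-a) (sym offset-b) (begin-strict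
        (base ℕ.* cut L a ℕ.+ digit a) ℕ.* P     <⟨ ℕₚ.*-monoˡ-< P {{ℕ.>-nonZero P-positive}} (ℕₚ.+-monoʳ-< (base ℕ.* cut L a) (digit<base a)) ⟩
        (base ℕ.* cut L a ℕ.+ base) ℕ.* P        ≡⟨ solve 3 (λ b k p → (b :* k :+ b) :* p := (con 1 :+ k) :* (b :* p)) refl base (cut L a) P ⟩
        suc (cut L a) ℕ.* (base ℕ.* P)           ≤⟨ ℕₚ.*-monoˡ-≤ (base ℕ.* P) lt ⟩
        key L b ℕ.* (base ℕ.* P)                 ∎)))
      where open ℕₚ.≤-Reasoning

  position-generic : ∀ a b → position a ≢ position b ℕ.+ scale
  position-generic a b eq with suc (suc (level b)) ℕ.≤? level a
  ... | yes far = ℕₚ.<-irrefl (sym eq) (far-level a b far)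
  ... | no ¬far with level a ℕ.≤? level b
  ...   | yes le = ℕₚ.<-irrefl eq (lower-or-same-level a b le)
  ...   | no ¬le with key (level b) b ℕ.≤? cut (level b) a
  ...     | yes ranked = ℕₚ.<-irrefl (sym eq) (NextLevel.jump-if-ranked a b next ranked)
    where next = ℕₚ.≤-antisym (ℕ.s≤s⁻¹ (ℕₚ.≰⇒> ¬far)) (ℕₚ.≰⇒> ¬le)
  ...     | no unranked = ℕₚ.<-irrefl eq (NextLevel.no-jump-if-unranked a b next (ℕₚ.≰⇒> unranked))
    where next = ℕₚ.≤-antisym (ℕ.s≤s⁻¹ (ℕₚ.≰⇒> ¬far)) (ℕₚ.≰⇒> ¬le)

  jumps-realised : ∀ a → count (λ b → edge a b ∧ does (position b ℕ.+ scale ℕ.<? position a)) ≡ t a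
  jumps-realised a = by-level (level a) refl
    where
    by-level : ∀ m → level a ≡ m → count (λ b → edge a b ∧ does (position b ℕ.+ scale ℕ.<? position a)) ≡ t a
    by-level zero    eq = ⊥-elim (ℕₚ.<-irrefl (sym eq) (level≥1 a))
    by-level (suc L) eq = begin
      count (λ b → edge a b ∧ does (position b ℕ.+ scale ℕ.<? position a))
        ≡⟨ count-∨ _ _ _ pointwise disjoint ⟩
      farBelow G level a ℕ.+ rankBelow (key L) L a (cut L a)
        ≡⟨ cong (farBelow G level a ℕ.+_) (rank-cut L a eq) ⟩
      farBelow G level a ℕ.+ needed a
        ≡⟨ ℕₚ.m+[n∸m]≡n (far≤t a) ⟩
      t a ∎
      where
      open ≡-Reasoning
      classify : ∀ b → position b ℕ.+ scale ℕ.< position a → suc (suc (level b)) ℕ.≤ level a ⊎ (level b ≡ L × key L b ℕ.≤ cut L a)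
      classify b lt with suc (suc (level b)) ℕ.≤? level a
      ... | yes far = inj₁ far
      ... | no ¬far with level a ℕ.≤? level b
      ...   | yes le = ⊥-elim (ℕₚ.<-asym lt (lower-or-same-level a b le))
      ...   | no ¬le = inj₂ (on-L , ranked)
        where
        next : level a ≡ suc (level b)
        next = ℕₚ.≤-antisym (ℕ.s≤s⁻¹ (ℕₚ.≰⇒> ¬far)) (ℕₚ.≰⇒> ¬le)
        on-L : level b ≡ L
        on-L = ℕₚ.suc-injective (trans (sym next) eq)
        ranked : key L b ℕ.≤ cut L a
        ranked = subst (λ l → key l b ℕ.≤ cut l a) on-L
                       (ℕₚ.≮⇒≥ (λ lt′ → ℕₚ.<-asym lt (NextLevel.no-jump-if-unranked a b next lt′)))
      ranked-jump : ∀ b → level b ≡ L × key L b ℕ.≤ cut L a → position b ℕ.+ scale ℕ.< position a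
      ranked-jump b (refl , le) = NextLevel.jump-if-ranked a b eq le
      pointwise : ∀ b → (edge a b ∧ does (position b ℕ.+ scale ℕ.<? position a)) ≡
        (edge a b ∧ does (suc (suc (level b)) ℕ.≤? level a)) ∨ (edge a b ∧ (does (level b ℕ.≟ L) ∧ does (key L b ℕ.≤? cut L a)))
      pointwise b = trans (cong (edge a b ∧_) (does-⊎ (position b ℕ.+ scale ℕ.<? position a) (suc (suc (level b)) ℕ.≤? level a)
                                                     ((level b ℕ.≟ L) ×-dec (key L b ℕ.≤? cut L a))
                                                     (classify b) (far-level a b) (ranked-jump b)))
                          (Boolₚ.∧-distribˡ-∨ (edge a b) _ _)
      disjoint : ∀ b → (edge a b ∧ does (suc (suc (level b)) ℕ.≤? level a)) ≡ true →
                 (edge a b ∧ (does (level b ℕ.≟ L) ∧ does (key L b ℕ.≤? cut L a))) ≡ false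
      disjoint b far with ∧-true⁻¹ {edge a b} far
      ... | _ , far′ rewrite dec-false (level b ℕ.≟ L) (λ on-L → ℕₚ.1+n≰n (ℕ.s≤s⁻¹
                               (subst₂ (λ u v → suc (suc u) ℕ.≤ v) on-L eq (dec-true⁻¹ (_ ℕ.≤? level a) far′)))) =
        Boolₚ.∧-zeroʳ (edge a b)

-- Superstable configurations label admissible regions

toℚ : ℕ → ℚ
toℚ zero    = 0ℚ
toℚ (suc k) = 1ℚ ℚ.+ toℚ k

toℚ-+ : ∀ a b → toℚ (a ℕ.+ b) ≡ toℚ a ℚ.+ toℚ b
toℚ-+ zero    b = sym (ℚₚ.+-identityˡ (toℚ b))
toℚ-+ (suc a) b = trans (cong (1ℚ ℚ.+_) (toℚ-+ a b)) (sym (ℚₚ.+-assoc 1ℚ (toℚ a) (toℚ b)))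

toℚ-positive : ∀ k → 0ℚ ℚ.< toℚ (suc k)
toℚ-positive zero    = ℚₚ.positive⁻¹ 1ℚ
toℚ-positive (suc k) = ℚₚ.<-trans (toℚ-positive k) (<-by-difference (toℚ (suc k)) 1ℚ (ℚₚ.+-comm 1ℚ (toℚ (suc k))) (ℚₚ.positive⁻¹ 1ℚ))

toℚ-mono-< : ∀ {a b} → a ℕ.< b → toℚ a ℚ.< toℚ b
toℚ-mono-< {a} {b} a<b = <-by-difference (toℚ a) (toℚ (suc (b ℕ.∸ suc a)))
  (trans (cong toℚ (sym (trans (ℕₚ.+-comm a _) (trans (sym (ℕₚ.+-suc (b ℕ.∸ suc a) a)) (ℕₚ.m∸n+n≡m a<b)))))
         (toℚ-+ a (suc (b ℕ.∸ suc a))))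
  (toℚ-positive (b ℕ.∸ suc a))

module Rescaled {n} (X : Fin n → ℕ) (D : ℕ) (D≥1 : 1 ℕ.≤ D) where

  instance
    D-positive : ℚ.Positive (toℚ D)
    D-positive = ℚ.positive (toℚ-mono-< D≥1)

  r : ℚ
  r = (ℚ.1/ toℚ D) {{ℚₚ.pos⇒nonZero (toℚ D)}}

  instance
    r-positive : ℚ.Positive r
    r-positive = ℚₚ.1/pos⇒pos (toℚ D)

  rD≡1 : r ℚ.* toℚ D ≡ 1ℚ
  rD≡1 = ℚₚ.*-inverseˡ (toℚ D) {{ℚₚ.pos⇒nonZero (toℚ D)}}

  point : Pt n
  point a = r ℚ.* toℚ (X a)

  point-diff : ∀ a b → point a ℚ.- point b ≡ r ℚ.* (toℚ (X a) ℚ.- toℚ (X b))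
  point-diff a b = solve 3 (λ r u v → r :* u :- r :* v := r :* (u :- v)) refl r (toℚ (X a)) (toℚ (X b))
    where open ℚ-Solver.+-*-Solver

  shifted : ∀ u v → (u ℚ.+ v) ℚ.- u ≡ v
  shifted u v = solve 2 (λ u v → (u :+ v) :- u := v) refl u v
    where open ℚ-Solver.+-*-Solver

  D-apart : ∀ a b → X b ℕ.+ D ℕ.< X a → Above point a b
  D-apart a b lt = subst₂ ℚ._<_ rD≡1 (sym (point-diff a b)) (ℚₚ.*-monoʳ-<-pos r
    (subst (ℚ._< toℚ (X a) ℚ.- toℚ (X b)) (shifted (toℚ (X b)) (toℚ D))
      (ℚₚ.+-monoˡ-< (ℚ.- toℚ (X b)) (subst (ℚ._< toℚ (X a)) (toℚ-+ (X b) D) (toℚ-mono-< lt)))))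

  D-close : ∀ a b → X a ℕ.< X b ℕ.+ D → Below point a b
  D-close a b lt = subst₂ ℚ._<_ (sym (point-diff a b)) rD≡1 (ℚₚ.*-monoʳ-<-pos r
    (subst (toℚ (X a) ℚ.- toℚ (X b) ℚ.<_) (shifted (toℚ (X b)) (toℚ D))
      (ℚₚ.+-monoˡ-< (ℚ.- toℚ (X b)) (subst (toℚ (X a) ℚ.<_) (toℚ-+ (X b) D) (toℚ-mono-< lt)))))

module Realisation {n} (G : SimpleGraph n) (c : Vec ℤ n) (c-superstable : Superstable (adj G) c) where
  open Arrangement G
  open Burning G c c-superstable
  module Pos = Positions G threshold level level≥1 level≤n far≤threshold threshold≤far+just
  open Pos using (position; scale; position-generic)
  module Scaled = Rescaled position scale (Pos.base^-positive n)
  open Scaled using (D-apart; D-close)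
  open Scaled public using (point)

  point-generic : Generic G point
  point-generic a b _ on with ℕₚ.<-cmp (position a) (position b ℕ.+ scale)
  ... | tri< close _ _ = ℚₚ.<-irrefl on (D-close a b close)
  ... | tri≈ _ same _  = position-generic a b same
  ... | tri> _ _ apart = ℚₚ.<-irrefl (sym on) (D-apart a b apart)

  above?≡ : ∀ a b → above? point a b ≡ does (position b ℕ.+ scale ℕ.<? position a)
  above?≡ a b = does-⇔ (mk⇔ apart (D-apart a b)) (1ℚ ℚₚ.<? (point a ℚ.- point b)) (position b ℕ.+ scale ℕ.<? position a)
    where
    apart : Above point a b → position b ℕ.+ scale ℕ.< position a
    apart above = by-cases (ℕₚ.<-cmp (position a) (position b ℕ.+ scale))
      where
      by-cases : Tri (position a ℕ.< position b ℕ.+ scale) (position a ≡ position b ℕ.+ scale)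
                     (position b ℕ.+ scale ℕ.< position a) → position b ℕ.+ scale ℕ.< position a
      by-cases (tri< close _ _) = ⊥-elim (above⇒¬below point a b above (D-close a b close))
      by-cases (tri≈ _ same _)  = ⊥-elim (position-generic a b same)
      by-cases (tri> _ _ apart) = apart

  jumps≡threshold : ∀ a → jumps point a ≡ threshold a
  jumps≡threshold a = trans (count-cong {f = jump point a} {g = λ b → edge a b ∧ does (position b ℕ.+ scale ℕ.<? position a)}
                                        (λ b → cong (edge a b ∧_) (above?≡ a b)))
                            (Pos.jumps-realised a)

  canonicalLabel-point : canonicalLabel point ≡ -1ℤ ∷ c
  canonicalLabel-point = lookup-ext _ _ at
    where
    at : ∀ u → lookup (canonicalLabel point) u ≡ lookup (-1ℤ ∷ c) u
    at zero    = refl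
    at (suc a) = trans (Vecₚ.lookup∘tabulate (canonicalLabelAt point) (suc a))
                       (trans (cong (λ m → sinkOffset a ℤ.+ + m) (jumps≡threshold a))
                              (trans (by-sink-edge (adj G (suc a) zero) refl) (+chips a)))
      where
      by-sink-edge : ∀ e → adj G (suc a) zero ≡ e → sinkOffset a ℤ.+ + threshold a ≡ + chips a
      by-sink-edge true  a~v₀ rewrite symmetric G zero (suc a) | a~v₀ = refl
      by-sink-edge false a≁v₀ rewrite symmetric G zero (suc a) | a≁v₀ = refl

  point-admissible : Admissible G point
  point-admissible a = by-sink-edge (adj G (suc a) zero) refl
    where
    by-sink-edge : ∀ e → adj G (suc a) zero ≡ e →
                   (adj G (suc a) zero ≡ true) ⊎ (∃[ j ] (adj G (suc a) (suc j) ≡ true × Above point a j))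
    by-sink-edge true  a~v₀ = inj₁ a~v₀
    by-sink-edge false a≁v₀ = inj₂ (some-jump (count-pos (jump point a) jumps≥1))
      where
      jumps≥1 : 1 ℕ.≤ jumps point a
      jumps≥1 = subst (1 ℕ.≤_) (sym (jumps≡threshold a))
                      (subst (λ e → 1 ℕ.≤ (if e then chips a else suc (chips a))) (sym a≁v₀) (s≤s z≤n))
      some-jump : ∃[ j ] jump point a j ≡ true → ∃[ j ] (adj G (suc a) (suc j) ≡ true × Above point a j)
      some-jump (j , jmp) = j , jump-sound point a j jmp

theorem4p11 : ∀ {n : ℕ} (G : SimpleGraph n) →
    Σ (Pt n → Divisor n) (IsPakStanley G) ×
    (∀ (lab : Pt n → Divisor n) → IsPakStanley G lab → ∀ (d : Divisor n) →
      ((∃[ x ] (Generic G x × Admissible G x × lab x ≡ d)) ⇔ InS̃₀ G d) ×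
      (InS̃₀ G d ⇔ (∃[ c ] (Superstable (adj G) c × d ≡ -1ℤ ∷ c))))
theorem4p11 G = (canonicalLabel , canonicalLabel-isPakStanley) ,
  λ lab lab-ps d → mk⇔ (image⊆ lab lab-ps) (⊆image lab lab-ps) , InS̃₀⇔superstable d
  where
  open Arrangement G
  open PakStanley G
  open AdmissibleRegions G
  open Cone G using (InS̃₀⇔superstable)

  image⊆ : ∀ lab → IsPakStanley G lab → ∀ {d} → ∃[ x ] (Generic G x × Admissible G x × lab x ≡ d) → InS̃₀ G d
  image⊆ lab lab-ps (x , x-generic , x-admissible , refl) =
    subst (InS̃₀ G) (sym (isPakStanley-unique lab lab-ps x x-generic)) (admissible-label∈S̃₀ x x-generic x-admissible)

  ⊆image : ∀ lab → IsPakStanley G lab → ∀ {d} → InS̃₀ G d → ∃[ x ] (Generic G x × Admissible G x × lab x ≡ d)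
  ⊆image lab lab-ps {d} d∈S̃₀ = realise (Equivalence.to (InS̃₀⇔superstable d) d∈S̃₀)
    where
    realise : ∃[ c ] (Superstable (adj G) c × d ≡ -1ℤ ∷ c) → ∃[ x ] (Generic G x × Admissible G x × lab x ≡ d)
    realise (c , c-superstable , refl) =
      point , point-generic , point-admissible , trans (isPakStanley-unique lab lab-ps point point-generic) canonicalLabel-point
      where open Realisation G c c-superstable
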